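{- Let $\xi$ be a finite collection of connected graphs each containing a cycle, let $k\ge1$, and suppose that for every $t$ with $1\le t\le k-1$, $$\widehat W_{t,\xi}(z)-\frac{b_t}{(1-T(z))^{3t}}+\frac{c^{(\xi)}_t}{(1-T(z))^{3t-1}}\succeq0.$$ Then $$\Lambda^{(\xi)}_k\succeq\frac{T(z)^2}{(1-T(z))^{3k+4}}\Big(9\mathcal B_k-6\,\mathcal C^{(\xi)}_k\,(1-T(z))\Big).$$
   Context: $T(z)=\sum_{n\ge1}n^{n-1}z^n/n!$; $\vartheta_z=z\frac{d}{dz}$. $\widehat W_{t,\xi}(z)=\sum_n g_{n,t}z^n/n!$ with $g_{n,t}$ the number of connected simple graphs on $\{1,\dots,n\}$ with $n+t$ edges containing no (not necessarily induced) subgraph isomorphic to a member of $\xi$. $A\succeq B$ means $[z^n]A\ge[z^n]B$ for all $n$; $A\succeq0$ means all coefficients are nonnegative. $\Lambda^{(\xi)}_k=\sum_{t=1}^{k-1}(\vartheta_z\widehat W_{t,\xi})(\vartheta_z\widehat W_{k-t,\xi})$ (empty sum $=0$). Wright's constants: $b_1=\frac5{24}$, $2(k+1)b_{k+1}=3k(k+1)b_k+3\sum_{t=1}^{k-1}t(k-t)b_tb_{k-t}$; $c_1=\frac{19}{24}$, $2(3k+2)c_{k+1}=8(k+1)b_{k+1}+3kb_k+(3k+2)(3k-1)c_k+6\sum_{t=1}^{k-1}t(3k-3t-1)b_tc_{k-t}$. With $r$ the number of cycles (of distinct lengths) in $\xi$: $c^{(\xi)}_1=\frac{19+6r}{24}$,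 $c^{(\xi)}_{k+1}=c_{k+1}+\frac32rkb_k$. Finally $\mathcal B_k=\sum_{t=1}^{k-1}t(k-t)b_tb_{k-t}$ and $\mathcal C^{(\xi)}_k=\sum_{t=1}^{k-1}t(3k-3t-1)b_tc^{(\xi)}_{k-t}$. -}

module Defs where

open import Data.Bool using (Bool; true; false; _∧_; _∨_; not; T; if_then_else_)
open import Data.Nat as ℕ using (ℕ; zero; suc; _≡ᵇ_; _<ᵇ_; _≤ᵇ_; _!; _^_; _∸_)
open import Data.Nat.Properties using (_!≢0)
open import Data.Integer as ℤ using (ℤ; +_)
open import Data.Rational as ℚ using (ℚ; 0ℚ; 1ℚ; _/_)
open import Data.Fin using (Fin; zero; suc; toℕ)
open import Data.List using (List; []; _∷_; [_]; map; concatMap; allFin; upTo; filterᵇ; length; foldr; _++_)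
open import Data.Bool.ListAction using (any; all)
open import Data.Product using (Σ; _×_; _,_; proj₁; proj₂; ∃)

fromℕ : ℕ → ℚ
fromℕ n = (+ n) / 1

sumℚ : List ℚ → ℚ
sumℚ = foldr ℚ._+_ 0ℚ

Σ₁ : ℕ → (ℕ → ℚ) → ℚ
Σ₁ k f = sumℚ (map (λ i → f (suc i)) (upTo (k ∸ 1)))

-- 1-indexed lookup in a list, default 0
get : List ℚ → ℕ → ℚ
get []       _             = 0ℚ
get (x ∷ xs) zero          = 0ℚ
get (x ∷ xs) (suc zero)    = x
get (x ∷ xs) (suc (suc n)) = get xs (suc n)

-- Wright's constants b_k, c_k (k ≥ 1); bc n = ([b_1..b_n], [c_1..c_n])

step : ℕ → List ℚ × List ℚ → List ℚ × List ℚ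
step K (bl , cl) = (bl ++ [ bK1 ]) , (cl ++ [ cK1 ])
  where
  bb : ℕ → ℚ
  bb = get bl
  cc : ℕ → ℚ
  cc = get cl
  bK1 : ℚ
  bK1 = ((+ 1) / (2 ℕ.* suc K)) ℚ.*
        (fromℕ (3 ℕ.* K ℕ.* suc K) ℚ.* bb K
         ℚ.+ fromℕ 3 ℚ.* Σ₁ K (λ t → fromℕ (t ℕ.* (K ∸ t)) ℚ.* bb t ℚ.* bb (K ∸ t)))
  cK1 : ℚ
  cK1 = ((+ 1) / (2 ℕ.* suc (suc (3 ℕ.* K)))) ℚ.*
        (fromℕ (8 ℕ.* suc K) ℚ.* bK1
         ℚ.+ fromℕ (3 ℕ.* K) ℚ.* bb K
         ℚ.+ fromℕ ((3 ℕ.* K ℕ.+ 2) ℕ.* (3 ℕ.* K ∸ 1)) ℚ.* cc K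
         ℚ.+ fromℕ 6 ℚ.* Σ₁ K (λ t → fromℕ (t ℕ.* (3 ℕ.* K ∸ 3 ℕ.* t ∸ 1)) ℚ.* bb t ℚ.* cc (K ∸ t)))

bc : ℕ → List ℚ × List ℚ
bc zero = [] , []
bc (suc zero) = [ (+ 5) / 24 ] , [ (+ 19) / 24 ]
bc (suc (suc k)) = step (suc k) (bc (suc k))

-- b k and c k for k ≥ 1 (value at k = 0 is 0, never used)
b : ℕ → ℚ
b k = get (proj₁ (bc k)) k

c : ℕ → ℚ
c k = get (proj₂ (bc k)) k

record Graph : Set where
  constructor mkGraph
  field
    v   : ℕ
    adj : Fin v → Fin v → Bool
open Graph public

_==_ : {n : ℕ} → Fin n → Fin n → Bool
i == j = toℕ i ≡ᵇ toℕ j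

allPairs : (n : ℕ) → (Fin n → Fin n → Bool) → Bool
allPairs n p = all (λ i → all (λ j → p i j) (allFin n)) (allFin n)

isSimple : (n : ℕ) → (Fin n → Fin n → Bool) → Bool
isSimple n a = allPairs n (λ i j → (a i j ≡ᵇᵇ a j i) ∧ not (a i i))
  where
  _≡ᵇᵇ_ : Bool → Bool → Bool
  true  ≡ᵇᵇ y = y
  false ≡ᵇᵇ y = not y

edgeCount : (n : ℕ) → (Fin n → Fin n → Bool) → ℕ
edgeCount n a = length (filterᵇ (λ p → (toℕ (proj₁ p) <ᵇ toℕ (proj₂ p)) ∧ a (proj₁ p) (proj₂ p))
                        (concatMap (λ i → map (λ j → i , j) (allFin n)) (allFin n)))

walk : (n : ℕ) → (Fin n → Fin n → Bool) → ℕ → Fin n → Fin n → Bool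
walk n a zero    i j = i == j
walk n a (suc s) i j = (i == j) ∨ any (λ m → a i m ∧ walk n a s m j) (allFin n)

-- connected: any two vertices joined by a walk (walks of length ≤ n suffice)
isConnected : (n : ℕ) → (Fin n → Fin n → Bool) → Bool
isConnected n a = allPairs n (walk n a n)

allFuns : {A : Set} → (m : ℕ) → List A → List (Fin m → A)
allFuns zero    xs = [ (λ ()) ]
allFuns (suc m) xs =
  concatMap (λ x → map (λ f → λ { zero → x ; (suc i) → f i }) (allFuns m xs)) xs

injectiveᵇ : {m n : ℕ} → (Fin m → Fin n) → Bool
injectiveᵇ {m} f = allPairs m (λ i j → not (f i == f j) ∨ (i == j))

-- host graph (n , a) contains a (not necessarily induced) subgraph isomorphic to H
containsᵇ : (n : ℕ) → (Fin n → Fin n → Bool) → Graph → Bool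
containsᵇ n a H =
  any (λ f → injectiveᵇ f ∧ allPairs (v H) (λ i j → not (adj H i j) ∨ a (f i) (f j)))
      (allFuns (v H) (allFin n))

cycleGraph : ℕ → Graph
cycleGraph ℓ = mkGraph ℓ (λ i j → nb i j ∨ nb j i)
  where
  nb : Fin ℓ → Fin ℓ → Bool
  nb i j = (suc (toℕ i) ≡ᵇ toℕ j) ∨ ((suc (toℕ i) ≡ᵇ ℓ) ∧ (toℕ j ≡ᵇ 0))

Connected : Graph → Set
Connected H = T (isConnected (v H) (adj H))

Simple : Graph → Set
Simple H = T (isSimple (v H) (adj H))

ContainsCycle : Graph → Set
ContainsCycle H = Σ ℕ (λ ℓ → T (3 ≤ᵇ ℓ) × T (containsᵇ (v H) (adj H) (cycleGraph ℓ)))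

isCycleᵇ : Graph → Bool
isCycleᵇ H = (3 ≤ᵇ v H) ∧
  any (λ f → injectiveᵇ f ∧ allPairs (v H) (λ i j → eqB (adj H i j) (adj (cycleGraph (v H)) (f i) (f j))))
      (allFuns (v H) (allFin (v H)))
  where
  eqB : Bool → Bool → Bool
  eqB true  y = y
  eqB false y = not y

maxV : List Graph → ℕ
maxV = foldr (λ H m → v H ℕ.⊔ m) 0

-- r = number of distinct lengths ℓ such that C_ℓ ∈ ξ (up to isomorphism)
rξ : List Graph → ℕ
rξ ξ = length (filterᵇ (λ ℓ → any (λ H → (v H ≡ᵇ ℓ) ∧ isCycleᵇ H) ξ) (upTo (suc (maxV ξ))))

-- g_{n,t}: connected simple graphs on Fin n with n+t edges, ξ-free.
-- Each simple graph is counted once as its (symmetric, loopless) adjacency matrix.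

g : List Graph → ℕ → ℕ → ℕ
g ξ n t = length (filterᵇ ok (allFuns n (allFuns n (true ∷ false ∷ []))))
  where
  ok : (Fin n → Fin n → Bool) → Bool
  ok a = isSimple n a ∧ (edgeCount n a ≡ᵇ n ℕ.+ t) ∧ isConnected n a
         ∧ all (λ H → not (containsᵇ n a H)) ξ

Series : Set
Series = ℕ → ℚ

_⊕_ : Series → Series → Series
(A ⊕ B) n = A n ℚ.+ B n

_⊖_ : Series → Series → Series
(A ⊖ B) n = A n ℚ.- B n

_·_ : ℚ → Series → Series
(q · A) n = q ℚ.* A n

_⊛_ : Series → Series → Series
(A ⊛ B) n = sumℚ (map (λ i → A i ℚ.* B (n ∸ i)) (upTo (suc n)))

infixl 7 _⊛_ _·_
infixl 6 _⊕_ _⊖_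

oneS : Series
oneS zero    = 1ℚ
oneS (suc n) = 0ℚ

powS : Series → ℕ → Series
powS A zero    = oneS
powS A (suc m) = A ⊛ powS A m

θ : Series → Series
θ A n = fromℕ n ℚ.* A n

Tz : Series
Tz zero    = 0ℚ
Tz (suc n) = _/_ (+ (suc n ^ n)) (suc n !) {{suc n !≢0}}

-- 1/(1 - T(z)) = Σ_j T(z)^j (T has zero constant term, so [z^n] only needs j ≤ n)
inv1mT : Series
inv1mT n = sumℚ (map (λ j → powS Tz j n) (upTo (suc n)))

invPow : ℕ → Series
invPow m = powS inv1mT m

oneMinusT : Series
oneMinusT = oneS ⊖ Tz

constS : ℚ → Series
constS q = q · oneS

_⪰_ : Series → Series → Set
A ⪰ B = ∀ n → B n ℚ.≤ A n

zeroS : Series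
zeroS _ = 0ℚ

Ŵ : List Graph → ℕ → Series
Ŵ ξ t n = _/_ (+ g ξ n t) (n !) {{n !≢0}}

Λ : List Graph → ℕ → Series
Λ ξ k n = sumℚ (map (λ t → (θ (Ŵ ξ t) ⊛ θ (Ŵ ξ (k ∸ t))) n) (map suc (upTo (k ∸ 1))))

cξ : List Graph → ℕ → ℚ
cξ ξ zero          = 0ℚ
cξ ξ (suc zero)    = (+ (19 ℕ.+ 6 ℕ.* rξ ξ)) / 24
cξ ξ (suc (suc k)) = c (suc (suc k)) ℚ.+ ((+ 3) / 2) ℚ.* fromℕ (rξ ξ ℕ.* suc k) ℚ.* b (suc k)

𝓑 : ℕ → ℚ
𝓑 k = Σ₁ k (λ t → fromℕ (t ℕ.* (k ∸ t)) ℚ.* b t ℚ.* b (k ∸ t))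

𝓒 : List Graph → ℕ → ℚ
𝓒 ξ k = Σ₁ k (λ t → fromℕ (t ℕ.* (3 ℕ.* k ∸ 3 ℕ.* t ∸ 1)) ℚ.* b t ℚ.* cξ ξ (k ∸ t))

{-# OPTIONS --safe #-}

-- Applying ϑ to the hypothesis gives ϑŴₜ ⪰ αₜ − δₜ with αₜ = bₜ ϑ(1−T)^(−3t) and
-- δₜ = cₜ ϑ(1−T)^(−(3t−1)), all three series having nonnegative coefficients.  For nonnegative
-- numbers, x ≥ a − b and y ≥ c − d imply xy ≥ ac − ad − bc, so termwise in the Cauchy product
-- ϑŴₜ ϑŴₖ₋ₜ ⪰ αₜαₖ₋ₜ − αₜδₖ₋ₜ − δₜαₖ₋ₜ.  Because ϑT = T/(1−T), ϑ(1−T)^(−m) = m T (1−T)^(−m−2),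
-- so the three products are explicit multiples of T²(1−T)^(−3k−4) and T²(1−T)^(−3k−3); summed over
-- t their coefficients are 9𝓑ₖ, 3𝓒ₖ and 3𝓒ₖ, and T²(1−T)^(−3k−3) = T²(1−T)^(−3k−4)(1−T).
--
-- The identity ϑT = T (1 + ϑT) is the coefficient of zⁿ in eⁿᶻ · z = eⁿᶻ · T(z e⁻ᶻ).  The functional
-- equation T(z e⁻ᶻ) = z in turn holds coefficientwise because Σₖ (−1)ᵐ⁻ᵏ kᵐ⁻¹ / (k! (m−k)!) is an
-- m-th finite difference of a polynomial of degree m − 1.
module Submission where

module NatEmbedding where

  open import Defs using (fromℕ)
  open import Data.Nat as ℕ using (ℕ; suc; _∸_)
  import Data.Nat.Properties as ℕ
  open import Data.Integer as ℤ using (+_)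
  import Data.Integer.Properties as ℤ
  open import Data.Rational using (ℚ; 0ℚ; 1ℚ; _+_; _*_; _-_; -_; _≤_; _/_; toℚᵘ)
  open import Data.Rational.Properties
  import Data.Rational.Unnormalised as ℚᵘ
  import Data.Rational.Unnormalised.Properties as ℚᵘ
  open import Relation.Binary.PropositionalEquality
  open import Data.Rational.Solver using (module +-*-Solver)
  open +-*-Solver

  private
    toℚᵘ-fromℕ : ∀ n → toℚᵘ (fromℕ n) ℚᵘ.≃ ℚᵘ.mkℚᵘ (+ n) 0
    toℚᵘ-fromℕ n = toℚᵘ-fromℚᵘ (ℚᵘ.mkℚᵘ (+ n) 0)

  fromℕ-+ : ∀ m n → fromℕ (m ℕ.+ n) ≡ fromℕ m + fromℕ n
  fromℕ-+ m n = toℚᵘ-injective (ℚᵘ.≃-trans (toℚᵘ-fromℕ (m ℕ.+ n))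
    (ℚᵘ.≃-trans (ℚᵘ.*≡* eq) (ℚᵘ.≃-sym (ℚᵘ.≃-trans (toℚᵘ-homo-+ (fromℕ m) (fromℕ n))
      (ℚᵘ.+-cong (toℚᵘ-fromℕ m) (toℚᵘ-fromℕ n))))))
    where
    eq : + (m ℕ.+ n) ℤ.* + 1 ≡ (+ m ℤ.* + 1 ℤ.+ + n ℤ.* + 1) ℤ.* + 1
    eq = cong (ℤ._* + 1) (trans (ℤ.pos-+ m n)
           (sym (cong₂ ℤ._+_ (ℤ.*-identityʳ (+ m)) (ℤ.*-identityʳ (+ n)))))

  fromℕ-* : ∀ m n → fromℕ (m ℕ.* n) ≡ fromℕ m * fromℕ n
  fromℕ-* m n = toℚᵘ-injective (ℚᵘ.≃-trans (toℚᵘ-fromℕ (m ℕ.* n))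
    (ℚᵘ.≃-trans (ℚᵘ.*≡* (cong (ℤ._* + 1) (ℤ.pos-* m n)))
      (ℚᵘ.≃-sym (ℚᵘ.≃-trans (toℚᵘ-homo-* (fromℕ m) (fromℕ n))
        (ℚᵘ.*-cong (toℚᵘ-fromℕ m) (toℚᵘ-fromℕ n))))))

  fromℕ-∸ : ∀ {m n} → n ℕ.≤ m → fromℕ (m ∸ n) ≡ fromℕ m - fromℕ n
  fromℕ-∸ {m} {n} n≤m = begin
    fromℕ (m ∸ n)                    ≡⟨ solve 2 (λ x y → y := (x :+ y) :- x) refl (fromℕ n) (fromℕ (m ∸ n)) ⟩
    (fromℕ n + fromℕ (m ∸ n)) - fromℕ n ≡⟨ cong (_- fromℕ n) (sym (fromℕ-+ n (m ∸ n))) ⟩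
    fromℕ (n ℕ.+ (m ∸ n)) - fromℕ n  ≡⟨ cong (λ x → fromℕ x - fromℕ n) (ℕ.m+[n∸m]≡n n≤m) ⟩
    fromℕ m - fromℕ n                ∎
    where open ≡-Reasoning

  fromℕ-*-/ : ∀ m d .{{_ : ℕ.NonZero d}} → fromℕ d * (+ m / d) ≡ fromℕ m
  fromℕ-*-/ m (suc d) = toℚᵘ-injective (ℚᵘ.≃-trans (toℚᵘ-homo-* (fromℕ (suc d)) (+ m / suc d))
    (ℚᵘ.≃-trans (ℚᵘ.*-cong (toℚᵘ-fromℕ (suc d)) (toℚᵘ-fromℚᵘ (ℚᵘ.mkℚᵘ (+ m) d)))
      (ℚᵘ.≃-trans (ℚᵘ.*≡* eq) (ℚᵘ.≃-sym (toℚᵘ-fromℕ m)))))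
    where
    eq : (+ suc d ℤ.* + m) ℤ.* + 1 ≡ + m ℤ.* (+ 1 ℤ.* + suc d)
    eq = trans (ℤ.*-identityʳ _) (trans (ℤ.*-comm (+ suc d) (+ m))
           (cong (+ m ℤ.*_) (sym (ℤ.*-identityˡ (+ suc d)))))

  fromℕ-cancelˡ : ∀ d .{{_ : ℕ.NonZero d}} {p q} → fromℕ d * p ≡ fromℕ d * q → p ≡ q
  fromℕ-cancelˡ d {p} {q} eq = begin
    p                     ≡⟨ *-identityˡ p ⟨
    1ℚ * p                ≡⟨ cong (_* p) (sym d⁻¹*d) ⟩
    (d⁻¹ * fromℕ d) * p   ≡⟨ *-assoc d⁻¹ (fromℕ d) p ⟩
    d⁻¹ * (fromℕ d * p)   ≡⟨ cong (d⁻¹ *_) eq ⟩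
    d⁻¹ * (fromℕ d * q)   ≡⟨ sym (*-assoc d⁻¹ (fromℕ d) q) ⟩
    (d⁻¹ * fromℕ d) * q   ≡⟨ cong (_* q) d⁻¹*d ⟩
    1ℚ * q                ≡⟨ *-identityˡ q ⟩
    q                     ∎
    where
    open ≡-Reasoning
    d⁻¹ : ℚ
    d⁻¹ = + 1 / d
    d⁻¹*d : d⁻¹ * fromℕ d ≡ 1ℚ
    d⁻¹*d = trans (*-comm d⁻¹ (fromℕ d)) (fromℕ-*-/ 1 d)

  /-as-* : ∀ m d .{{_ : ℕ.NonZero d}} → + m / d ≡ fromℕ m * (+ 1 / d)
  /-as-* m d = fromℕ-cancelˡ d (begin
    fromℕ d * (+ m / d)             ≡⟨ fromℕ-*-/ m d ⟩
    fromℕ m                         ≡⟨ sym (*-identityʳ (fromℕ m)) ⟩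
    fromℕ m * 1ℚ                    ≡⟨ cong (fromℕ m *_) (sym (fromℕ-*-/ 1 d)) ⟩
    fromℕ m * (fromℕ d * (+ 1 / d)) ≡⟨ solve 3 (λ m d r → m :* (d :* r) := d :* (m :* r))
                                                  refl (fromℕ m) (fromℕ d) (+ 1 / d) ⟩
    fromℕ d * (fromℕ m * (+ 1 / d)) ∎)
    where open ≡-Reasoning

  0≤/ : ∀ m d .{{_ : ℕ.NonZero d}} → 0ℚ ≤ + m / d
  0≤/ m d = nonNegative⁻¹ _ {{normalize-nonNeg m d}}

  0≤fromℕ : ∀ n → 0ℚ ≤ fromℕ n
  0≤fromℕ n = 0≤/ n 1


module RationalOrder where

  open import Data.Rational using (0ℚ; _+_; _*_; _-_; -_; _≤_; nonNegative)
  open import Data.Rational.Properties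
  open import Relation.Binary.PropositionalEquality
  open import Relation.Nullary using (yes; no)
  open import Data.Rational.Solver using (module +-*-Solver)
  open +-*-Solver

  0≤* : ∀ {p q} → 0ℚ ≤ p → 0ℚ ≤ q → 0ℚ ≤ p * q
  0≤* {p} {q} 0≤p 0≤q = nonNegative⁻¹ (p * q)
    {{nonNeg*nonNeg⇒nonNeg p {{nonNegative 0≤p}} q {{nonNegative 0≤q}}}}

  0≤+ : ∀ {p q} → 0ℚ ≤ p → 0ℚ ≤ q → 0ℚ ≤ p + q
  0≤+ 0≤p 0≤q = +-mono-≤ 0≤p 0≤q

  p≤q⇒0≤q-p : ∀ {p q} → p ≤ q → 0ℚ ≤ q - p
  p≤q⇒0≤q-p {p} p≤q = ≤-trans (≤-reflexive (sym (+-inverseʳ p))) (+-monoˡ-≤ (- p) p≤q)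

  0≤q-p⇒p≤q : ∀ {p q} → 0ℚ ≤ q - p → p ≤ q
  0≤q-p⇒p≤q {p} {q} 0≤q-p = subst₂ _≤_ (+-identityˡ p)
    (solve 2 (λ p q → q :- p :+ p := q) refl p q) (+-monoˡ-≤ p 0≤q-p)

  -- If b ≤ a then xy ≥ (a - b)(c - d) ≥ ac - ad - bc; otherwise ac - ad - bc ≤ (a - b)c ≤ 0.
  a-b≤x∧c-d≤y⇒ac-ad-bc≤xy : ∀ {x y a b c d} → 0ℚ ≤ x → 0ℚ ≤ y →
    0ℚ ≤ a → 0ℚ ≤ b → 0ℚ ≤ c → 0ℚ ≤ d → a - b ≤ x → c - d ≤ y → a * c - a * d - b * c ≤ x * y
  a-b≤x∧c-d≤y⇒ac-ad-bc≤xy {x} {y} {a} {b} {c} {d} 0≤x 0≤y 0≤a 0≤b 0≤c 0≤d a-b≤x c-d≤y with b ≤? a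
  ... | yes b≤a = 0≤q-p⇒p≤q (subst (0ℚ ≤_) eq (0≤+ (0≤+ (0≤* (p≤q⇒0≤q-p a-b≤x) 0≤y)
          (0≤* (p≤q⇒0≤q-p b≤a) (p≤q⇒0≤q-p c-d≤y))) (0≤* 0≤b 0≤d)))
    where
    eq : (x - (a - b)) * y + (a - b) * (y - (c - d)) + b * d ≡ x * y - (a * c - a * d - b * c)
    eq = solve 6 (λ x y a b c d → (x :- (a :- b)) :* y :+ (a :- b) :* (y :- (c :- d)) :+ b :* d
                                 := x :* y :- (a :* c :- a :* d :- b :* c)) refl x y a b c d
  ... | no b≰a = 0≤q-p⇒p≤q (subst (0ℚ ≤_) eq (0≤+ (0≤+ (0≤* 0≤x 0≤y)
          (0≤* (p≤q⇒0≤q-p (<⇒≤ (≰⇒> b≰a))) 0≤c)) (0≤* 0≤a 0≤d)))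
    where
    eq : x * y + (b - a) * c + a * d ≡ x * y - (a * c - a * d - b * c)
    eq = solve 6 (λ x y a b c d → x :* y :+ (b :- a) :* c :+ a :* d
                                 := x :* y :- (a :* c :- a :* d :- b :* c)) refl x y a b c d

module FiniteSums where

  open import Defs using (sumℚ)
  open import Data.Nat as ℕ using (ℕ; zero; suc; _∸_; z≤n; s≤s; _<_)
  import Data.Nat.Properties as ℕ
  open import Data.Rational using (ℚ; 0ℚ; 1ℚ; _+_; _*_; _-_; -_; _≤_)
  open import Data.Rational.Properties
  open import Data.List using (map; upTo; applyUpTo)
  open import Relation.Binary.PropositionalEquality
  open import Relation.Nullary using (yes; no; contradiction)
  open import Function using (id)
  open import Data.Rational.Solver using (module +-*-Solver)
  open +-*-Solver

  ∑ : (ℕ → ℚ) → ℕ → ℚ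
  ∑ f zero    = 0ℚ
  ∑ f (suc n) = f 0 + ∑ (λ i → f (suc i)) n

  sumℚ-map-applyUpTo : ∀ (f : ℕ → ℚ) (g : ℕ → ℕ) n → sumℚ (map f (applyUpTo g n)) ≡ ∑ (λ i → f (g i)) n
  sumℚ-map-applyUpTo f g zero    = refl
  sumℚ-map-applyUpTo f g (suc n) = cong (f (g 0) +_) (sumℚ-map-applyUpTo f (λ i → g (suc i)) n)

  sumℚ-map-upTo : ∀ (f : ℕ → ℚ) n → sumℚ (map f (upTo n)) ≡ ∑ f n
  sumℚ-map-upTo f = sumℚ-map-applyUpTo f id

  ∑-cong : ∀ {f g} n → (∀ i → i < n → f i ≡ g i) → ∑ f n ≡ ∑ g n
  ∑-cong zero    f≡g = refl
  ∑-cong (suc n) f≡g = cong₂ _+_ (f≡g 0 (s≤s z≤n)) (∑-cong n (λ i i<n → f≡g (suc i) (s≤s i<n)))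

  ∑-zero : ∀ {f} n → (∀ i → i < n → f i ≡ 0ℚ) → ∑ f n ≡ 0ℚ
  ∑-zero zero    f≡0 = refl
  ∑-zero (suc n) f≡0 = trans (cong₂ _+_ (f≡0 0 (s≤s z≤n)) (∑-zero n (λ i i<n → f≡0 (suc i) (s≤s i<n))))
                             (+-identityˡ 0ℚ)

  ∑-last : ∀ (f : ℕ → ℚ) n → ∑ f (suc n) ≡ ∑ f n + f n
  ∑-last f zero    = +-comm (f 0) 0ℚ
  ∑-last f (suc n) = trans (cong (f 0 +_) (∑-last (λ i → f (suc i)) n)) (sym (+-assoc (f 0) _ _))

  ∑-distrib-+ : ∀ (f g : ℕ → ℚ) n → ∑ (λ i → f i + g i) n ≡ ∑ f n + ∑ g n
  ∑-distrib-+ f g zero    = sym (+-identityˡ 0ℚ)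
  ∑-distrib-+ f g (suc n) = trans (cong (f 0 + g 0 +_) (∑-distrib-+ (λ i → f (suc i)) (λ i → g (suc i)) n))
    (solve 4 (λ a b c d → (a :+ b) :+ (c :+ d) := (a :+ c) :+ (b :+ d)) refl (f 0) (g 0) _ _)

  ∑-*ˡ : ∀ q (f : ℕ → ℚ) n → ∑ (λ i → q * f i) n ≡ q * ∑ f n
  ∑-*ˡ q f zero    = sym (*-zeroʳ q)
  ∑-*ˡ q f (suc n) = trans (cong (q * f 0 +_) (∑-*ˡ q (λ i → f (suc i)) n)) (sym (*-distribˡ-+ q (f 0) _))

  ∑-*ʳ : ∀ q (f : ℕ → ℚ) n → ∑ (λ i → f i * q) n ≡ ∑ f n * q
  ∑-*ʳ q f n = trans (∑-cong n (λ i _ → *-comm (f i) q)) (trans (∑-*ˡ q f n) (*-comm q (∑ f n)))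

  ∑-distrib-minus : ∀ (f g : ℕ → ℚ) n → ∑ (λ i → f i - g i) n ≡ ∑ f n - ∑ g n
  ∑-distrib-minus f g n = begin
    ∑ (λ i → f i - g i) n              ≡⟨ ∑-distrib-+ f (λ i → - g i) n ⟩
    ∑ f n + ∑ (λ i → - g i) n          ≡⟨ cong (∑ f n +_) (∑-cong n (λ i _ → -p≡-1*p (g i))) ⟩
    ∑ f n + ∑ (λ i → - 1ℚ * g i) n     ≡⟨ cong (∑ f n +_) (∑-*ˡ (- 1ℚ) g n) ⟩
    ∑ f n + - 1ℚ * ∑ g n               ≡⟨ cong (∑ f n +_) (sym (-p≡-1*p (∑ g n))) ⟩
    ∑ f n - ∑ g n                      ∎
    where
    open ≡-Reasoning
    -p≡-1*p : ∀ p → - p ≡ - 1ℚ * p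
    -p≡-1*p = solve 1 (λ p → :- p := :- con 1ℚ :* p) refl

  ∑-swap : ∀ (f : ℕ → ℕ → ℚ) m n → ∑ (λ i → ∑ (λ j → f i j) m) n ≡ ∑ (λ j → ∑ (λ i → f i j) n) m
  ∑-swap f m zero    = sym (∑-zero m (λ _ _ → refl))
  ∑-swap f m (suc n) = trans (cong (∑ (f 0) m +_) (∑-swap (λ i → f (suc i)) m n))
                             (sym (∑-distrib-+ (f 0) (λ j → ∑ (λ i → f (suc i) j) n) m))

  ∑-mono-≤ : ∀ {f g} n → (∀ i → i < n → f i ≤ g i) → ∑ f n ≤ ∑ g n
  ∑-mono-≤ zero    f≤g = ≤-refl
  ∑-mono-≤ (suc n) f≤g = +-mono-≤ (f≤g 0 (s≤s z≤n)) (∑-mono-≤ n (λ i i<n → f≤g (suc i) (s≤s i<n)))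

  0≤∑ : ∀ {f} n → (∀ i → i < n → 0ℚ ≤ f i) → 0ℚ ≤ ∑ f n
  0≤∑ n 0≤f = ≤-trans (≤-reflexive (sym (∑-zero n (λ _ _ → refl)))) (∑-mono-≤ n 0≤f)

  ∑-reverse : ∀ (f : ℕ → ℚ) n → ∑ f n ≡ ∑ (λ i → f (n ∸ suc i)) n
  ∑-reverse f zero    = refl
  ∑-reverse f (suc n) = begin
    f 0 + ∑ (λ i → f (suc i)) n              ≡⟨ cong (f 0 +_) (∑-reverse (λ i → f (suc i)) n) ⟩
    f 0 + ∑ (λ i → f (suc (n ∸ suc i))) n    ≡⟨ cong₂ _+_ (cong f (sym (ℕ.n∸n≡0 n)))
                                                  (∑-cong n (λ i i<n → cong f (sym (ℕ.+-∸-assoc 1 i<n)))) ⟩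
    f (n ∸ n) + ∑ (λ i → f (n ∸ i)) n        ≡⟨ +-comm (f (n ∸ n)) _ ⟩
    ∑ (λ i → f (n ∸ i)) n + f (n ∸ n)        ≡⟨ sym (∑-last (λ i → f (n ∸ i)) n) ⟩
    ∑ (λ i → f (n ∸ i)) (suc n)              ∎
    where open ≡-Reasoning

  ∑-extend : ∀ {f g} m n → (∀ i → i < m → f i ≡ g i) → (∀ i → g (m ℕ.+ i) ≡ 0ℚ) →
             ∑ f m ≡ ∑ g (m ℕ.+ n)
  ∑-extend {g = g} zero n f≡g g≡0 = sym (∑-zero n (λ i _ → g≡0 i))
  ∑-extend (suc m) n f≡g g≡0 =
    cong₂ _+_ (f≡g 0 (s≤s z≤n)) (∑-extend m n (λ i i<m → f≡g (suc i) (s≤s i<m)) g≡0)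

  private
    ∑-pad : ∀ {h r} n i → i ℕ.≤ n →
            (∀ j → j ℕ.+ i ℕ.≤ n → r j ≡ h j) → (∀ j → n < j ℕ.+ i → r j ≡ 0ℚ) →
            ∑ h (suc (n ∸ i)) ≡ ∑ r (suc n)
    ∑-pad {r = r} n i i≤n r≡h r≡0 = trans
      (∑-extend (suc (n ∸ i)) i (λ j j<1+n-i → sym (r≡h j (ℕ.m≤o∸n⇒m+n≤o j i≤n (ℕ.≤-pred j<1+n-i))))
                                (λ j → r≡0 _ (ℕ.≤-trans (s≤s (ℕ.≤-reflexive (sym (ℕ.m∸n+n≡m i≤n))))
                                                       (ℕ.+-monoˡ-≤ i (ℕ.m≤m+n (suc (n ∸ i)) j)))))
      (cong (∑ r) (cong suc (ℕ.m∸n+n≡m i≤n)))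

    restrict : ℕ → (ℕ → ℕ → ℚ) → ℕ → ℕ → ℚ
    restrict n f i j with i ℕ.+ j ℕ.≤? n
    ... | yes _ = f i j
    ... | no _  = 0ℚ

    restrict-≤ : ∀ n f i j → i ℕ.+ j ℕ.≤ n → restrict n f i j ≡ f i j
    restrict-≤ n f i j i+j≤n with i ℕ.+ j ℕ.≤? n
    ... | yes _    = refl
    ... | no i+j≰n = contradiction i+j≤n i+j≰n

    restrict-> : ∀ n f i j → n < i ℕ.+ j → restrict n f i j ≡ 0ℚ
    restrict-> n f i j n<i+j with i ℕ.+ j ℕ.≤? n
    ... | yes i+j≤n = contradiction i+j≤n (ℕ.<⇒≱ n<i+j)
    ... | no _      = refl

  ∑-triangle-swap : ∀ (f : ℕ → ℕ → ℚ) n →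
    ∑ (λ i → ∑ (f i) (suc (n ∸ i))) (suc n) ≡ ∑ (λ j → ∑ (λ i → f i j) (suc (n ∸ j))) (suc n)
  ∑-triangle-swap f n = begin
    ∑ (λ i → ∑ (f i) (suc (n ∸ i))) (suc n)
      ≡⟨ ∑-cong (suc n) (λ i i<1+n → rows i (ℕ.≤-pred i<1+n)) ⟩
    ∑ (λ i → ∑ (restrict n f i) (suc n)) (suc n)
      ≡⟨ ∑-swap (restrict n f) (suc n) (suc n) ⟩
    ∑ (λ j → ∑ (λ i → restrict n f i j) (suc n)) (suc n)
      ≡⟨ ∑-cong (suc n) (λ j j<1+n → columns j (ℕ.≤-pred j<1+n)) ⟨
    ∑ (λ j → ∑ (λ i → f i j) (suc (n ∸ j))) (suc n) ∎
    where
    open ≡-Reasoning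
    rows : ∀ i → i ℕ.≤ n → ∑ (f i) (suc (n ∸ i)) ≡ ∑ (restrict n f i) (suc n)
    rows i i≤n = ∑-pad n i i≤n (λ j j+i≤n → restrict-≤ n f i j (subst (ℕ._≤ n) (ℕ.+-comm j i) j+i≤n))
                               (λ j n<j+i → restrict-> n f i j (subst (n <_) (ℕ.+-comm j i) n<j+i))
    columns : ∀ j → j ℕ.≤ n → ∑ (λ i → f i j) (suc (n ∸ j)) ≡ ∑ (λ i → restrict n f i j) (suc n)
    columns j j≤n = ∑-pad n j j≤n (λ i → restrict-≤ n f i j) (λ i → restrict-> n f i j)


module PowerSeries where

  open import Defs using (Series; _⊕_; _⊖_; _·_; _⊛_; oneS; zeroS; powS; θ; fromℕ; _⪰_)
  open NatEmbedding
  open RationalOrder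
  open FiniteSums
  open import Data.Nat as ℕ using (ℕ; zero; suc; _∸_; s≤s; _<_)
  import Data.Nat.Properties as ℕ
  open import Data.Rational using (ℚ; 0ℚ; 1ℚ; _+_; _*_; _-_; -_; _≤_)
  open import Data.Rational.Properties
  open import Relation.Binary.PropositionalEquality
  open import Data.Rational.Solver using (module +-*-Solver)
  open +-*-Solver

  infix 4 _≋_
  _≋_ : Series → Series → Set
  A ≋ B = ∀ n → A n ≡ B n

  tailS : Series → Series
  tailS A n = A (suc n)

  ⊛-coeff : ∀ A B n → (A ⊛ B) n ≡ ∑ (λ i → A i * B (n ∸ i)) (suc n)
  ⊛-coeff A B n = sumℚ-map-upTo (λ i → A i * B (n ∸ i)) (suc n)

  ⊛-coeff-0 : ∀ A B → (A ⊛ B) 0 ≡ A 0 * B 0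
  ⊛-coeff-0 A B = +-identityʳ (A 0 * B 0)

  ⊛-coeff-suc : ∀ A B n → (A ⊛ B) (suc n) ≡ A 0 * B (suc n) + (tailS A ⊛ B) n
  ⊛-coeff-suc A B n = trans (⊛-coeff A B (suc n)) (cong (A 0 * B (suc n) +_) (sym (⊛-coeff (tailS A) B n)))

  ⊛-congˡ : ∀ {A A′} B → A ≋ A′ → A ⊛ B ≋ A′ ⊛ B
  ⊛-congˡ {A} {A′} B A≋A′ n = trans (⊛-coeff A B n)
    (trans (∑-cong (suc n) (λ i _ → cong (_* B (n ∸ i)) (A≋A′ i))) (sym (⊛-coeff A′ B n)))

  ⊛-congʳ : ∀ A {B B′} → B ≋ B′ → A ⊛ B ≋ A ⊛ B′
  ⊛-congʳ A {B} {B′} B≋B′ n = trans (⊛-coeff A B n)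
    (trans (∑-cong (suc n) (λ i _ → cong (A i *_) (B≋B′ (n ∸ i)))) (sym (⊛-coeff A B′ n)))

  ⊛-cong : ∀ {A A′ B B′} → A ≋ A′ → B ≋ B′ → A ⊛ B ≋ A′ ⊛ B′
  ⊛-cong {A′ = A′} {B = B} A≋A′ B≋B′ n = trans (⊛-congˡ B A≋A′ n) (⊛-congʳ A′ B≋B′ n)

  ⊛-comm : ∀ A B → A ⊛ B ≋ B ⊛ A
  ⊛-comm A B n = begin
    (A ⊛ B) n                                    ≡⟨ ⊛-coeff A B n ⟩
    ∑ (λ i → A i * B (n ∸ i)) (suc n)             ≡⟨ ∑-reverse (λ i → A i * B (n ∸ i)) (suc n) ⟩
    ∑ (λ i → A (n ∸ i) * B (n ∸ (n ∸ i))) (suc n) ≡⟨ ∑-cong (suc n) (λ i i<1+n → swap i (ℕ.≤-pred i<1+n)) ⟩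
    ∑ (λ i → B i * A (n ∸ i)) (suc n)             ≡⟨ ⊛-coeff B A n ⟨
    (B ⊛ A) n                                    ∎
    where
    open ≡-Reasoning
    swap : ∀ i → i ℕ.≤ n → A (n ∸ i) * B (n ∸ (n ∸ i)) ≡ B i * A (n ∸ i)
    swap i i≤n = trans (*-comm (A (n ∸ i)) (B (n ∸ (n ∸ i)))) (cong (λ j → B j * A (n ∸ i)) (ℕ.m∸[m∸n]≡n i≤n))

  ⊛-distribʳ-⊕ : ∀ A B C → (B ⊕ C) ⊛ A ≋ B ⊛ A ⊕ C ⊛ A
  ⊛-distribʳ-⊕ A B C n = trans (⊛-coeff (B ⊕ C) A n)
    (trans (∑-cong (suc n) (λ i _ → *-distribʳ-+ (A (n ∸ i)) (B i) (C i)))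
      (trans (∑-distrib-+ (λ i → B i * A (n ∸ i)) (λ i → C i * A (n ∸ i)) (suc n))
        (sym (cong₂ _+_ (⊛-coeff B A n) (⊛-coeff C A n)))))

  ⊛-distribʳ-⊖ : ∀ A B C → (B ⊖ C) ⊛ A ≋ B ⊛ A ⊖ C ⊛ A
  ⊛-distribʳ-⊖ A B C n = trans (⊛-coeff (B ⊖ C) A n)
    (trans (∑-cong (suc n) (λ i _ → solve 3 (λ a b c → (b :- c) :* a := b :* a :- c :* a) refl (A (n ∸ i)) (B i) (C i)))
      (trans (∑-distrib-minus (λ i → B i * A (n ∸ i)) (λ i → C i * A (n ∸ i)) (suc n))
        (sym (cong₂ _-_ (⊛-coeff B A n) (⊛-coeff C A n)))))

  ·-⊛ : ∀ q A B → (q · A) ⊛ B ≋ q · (A ⊛ B)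
  ·-⊛ q A B n = trans (⊛-coeff (q · A) B n)
    (trans (∑-cong (suc n) (λ i _ → *-assoc q (A i) (B (n ∸ i))))
      (trans (∑-*ˡ q (λ i → A i * B (n ∸ i)) (suc n)) (cong (q *_) (sym (⊛-coeff A B n)))))

  ⊛-distribˡ-⊕ : ∀ A B C → A ⊛ (B ⊕ C) ≋ A ⊛ B ⊕ A ⊛ C
  ⊛-distribˡ-⊕ A B C n = trans (⊛-comm A (B ⊕ C) n)
    (trans (⊛-distribʳ-⊕ A B C n) (cong₂ _+_ (⊛-comm B A n) (⊛-comm C A n)))

  ⊛-distribˡ-⊖ : ∀ A B C → A ⊛ (B ⊖ C) ≋ A ⊛ B ⊖ A ⊛ C
  ⊛-distribˡ-⊖ A B C n = trans (⊛-comm A (B ⊖ C) n)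
    (trans (⊛-distribʳ-⊖ A B C n) (cong₂ _-_ (⊛-comm B A n) (⊛-comm C A n)))

  ⊛-· : ∀ q A B → A ⊛ (q · B) ≋ q · (A ⊛ B)
  ⊛-· q A B n = trans (⊛-comm A (q · B) n) (trans (·-⊛ q B A n) (cong (q *_) (⊛-comm B A n)))

  ⊛-assoc : ∀ A B C → (A ⊛ B) ⊛ C ≋ A ⊛ (B ⊛ C)
  ⊛-assoc A B C zero = begin
    ((A ⊛ B) ⊛ C) 0       ≡⟨ trans (⊛-coeff-0 (A ⊛ B) C) (cong (_* C 0) (⊛-coeff-0 A B)) ⟩
    A 0 * B 0 * C 0       ≡⟨ *-assoc (A 0) (B 0) (C 0) ⟩
    A 0 * (B 0 * C 0)     ≡⟨ sym (trans (⊛-coeff-0 A (B ⊛ C)) (cong (A 0 *_) (⊛-coeff-0 B C))) ⟩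
    (A ⊛ (B ⊛ C)) 0       ∎
    where open ≡-Reasoning
  ⊛-assoc A B C (suc n) = begin
    ((A ⊛ B) ⊛ C) (suc n)
      ≡⟨ ⊛-coeff-suc (A ⊛ B) C n ⟩
    (A ⊛ B) 0 * C (suc n) + (tailS (A ⊛ B) ⊛ C) n
      ≡⟨ cong₂ _+_ (cong (_* C (suc n)) (⊛-coeff-0 A B)) (⊛-congˡ C (⊛-coeff-suc A B) n) ⟩
    A 0 * B 0 * C (suc n) + ((A 0 · tailS B ⊕ tailS A ⊛ B) ⊛ C) n
      ≡⟨ cong (A 0 * B 0 * C (suc n) +_) (trans (⊛-distribʳ-⊕ C (A 0 · tailS B) (tailS A ⊛ B) n)
           (cong₂ _+_ (·-⊛ (A 0) (tailS B) C n) (⊛-assoc (tailS A) B C n))) ⟩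
    A 0 * B 0 * C (suc n) + (A 0 * (tailS B ⊛ C) n + (tailS A ⊛ (B ⊛ C)) n)
      ≡⟨ solve 5 (λ a b c d e → a :* b :* c :+ (a :* d :+ e) := a :* (b :* c :+ d) :+ e)
           refl (A 0) (B 0) (C (suc n)) _ _ ⟩
    A 0 * (B 0 * C (suc n) + (tailS B ⊛ C) n) + (tailS A ⊛ (B ⊛ C)) n
      ≡⟨ cong (λ x → A 0 * x + (tailS A ⊛ (B ⊛ C)) n) (sym (⊛-coeff-suc B C n)) ⟩
    A 0 * (B ⊛ C) (suc n) + (tailS A ⊛ (B ⊛ C)) n
      ≡⟨ sym (⊛-coeff-suc A (B ⊛ C) n) ⟩
    (A ⊛ (B ⊛ C)) (suc n) ∎
    where open ≡-Reasoning

  ⊛-identityˡ : ∀ A → oneS ⊛ A ≋ A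
  ⊛-identityˡ A zero    = trans (⊛-coeff-0 oneS A) (*-identityˡ (A 0))
  ⊛-identityˡ A (suc n) = trans (⊛-coeff-suc oneS A n)
    (trans (cong₂ _+_ (*-identityˡ (A (suc n)))
                      (trans (⊛-coeff (tailS oneS) A n) (∑-zero (suc n) (λ i _ → *-zeroˡ (A (n ∸ i))))))
           (+-identityʳ (A (suc n))))

  ⊛-identityʳ : ∀ A → A ⊛ oneS ≋ A
  ⊛-identityʳ A n = trans (⊛-comm A oneS n) (⊛-identityˡ A n)

  ⊛-zeroʳ : ∀ A → A ⊛ zeroS ≋ zeroS
  ⊛-zeroʳ A n = trans (⊛-coeff A zeroS n) (∑-zero (suc n) (λ i _ → *-zeroʳ (A i)))

  powS-+ : ∀ A m n → powS A (m ℕ.+ n) ≋ powS A m ⊛ powS A n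
  powS-+ A zero    n k = sym (⊛-identityˡ (powS A n) k)
  powS-+ A (suc m) n k = trans (⊛-congʳ A (powS-+ A m n) k) (sym (⊛-assoc A (powS A m) (powS A n) k))

  powS-vanish : ∀ A → A 0 ≡ 0ℚ → ∀ j n → n < j → powS A j n ≡ 0ℚ
  powS-vanish A A₀≡0 (suc j) zero _ =
    trans (⊛-coeff-0 A (powS A j)) (trans (cong (_* powS A j 0) A₀≡0) (*-zeroˡ (powS A j 0)))
  powS-vanish A A₀≡0 (suc j) (suc n) (s≤s n<j) = trans (⊛-coeff-suc A (powS A j) n)
    (trans (cong₂ _+_ (trans (cong (_* powS A j (suc n)) A₀≡0) (*-zeroˡ (powS A j (suc n))))
                      (trans (⊛-coeff (tailS A) (powS A j) n) (∑-zero (suc n) (λ i _ →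
                        trans (cong (A (suc i) *_) (powS-vanish A A₀≡0 j (n ∸ i) (ℕ.≤-<-trans (ℕ.m∸n≤m n i) n<j)))
                              (*-zeroʳ (A (suc i)))))))
           (+-identityˡ 0ℚ))

  θ-cong : ∀ {A B} → A ≋ B → θ A ≋ θ B
  θ-cong A≋B n = cong (fromℕ n *_) (A≋B n)

  θ-⊕ : ∀ A B → θ (A ⊕ B) ≋ θ A ⊕ θ B
  θ-⊕ A B n = *-distribˡ-+ (fromℕ n) (A n) (B n)

  θ-⊖ : ∀ A B → θ (A ⊖ B) ≋ θ A ⊖ θ B
  θ-⊖ A B n = solve 3 (λ x a b → x :* (a :- b) := x :* a :- x :* b) refl (fromℕ n) (A n) (B n)

  θ-· : ∀ q A → θ (q · A) ≋ q · θ A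
  θ-· q A n = solve 3 (λ x q a → x :* (q :* a) := q :* (x :* a)) refl (fromℕ n) q (A n)

  θ-oneS : θ oneS ≋ zeroS
  θ-oneS zero    = *-zeroˡ 1ℚ
  θ-oneS (suc n) = *-zeroʳ (fromℕ (suc n))

  θ-⊛ : ∀ A B → θ (A ⊛ B) ≋ θ A ⊛ B ⊕ A ⊛ θ B
  θ-⊛ A B n = begin
    fromℕ n * (A ⊛ B) n
      ≡⟨ cong (fromℕ n *_) (⊛-coeff A B n) ⟩
    fromℕ n * ∑ (λ i → A i * B (n ∸ i)) (suc n)
      ≡⟨ sym (∑-*ˡ (fromℕ n) (λ i → A i * B (n ∸ i)) (suc n)) ⟩
    ∑ (λ i → fromℕ n * (A i * B (n ∸ i))) (suc n)
      ≡⟨ ∑-cong (suc n) (λ i i<1+n → leibniz i (ℕ.≤-pred i<1+n)) ⟩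
    ∑ (λ i → fromℕ i * A i * B (n ∸ i) + A i * (fromℕ (n ∸ i) * B (n ∸ i))) (suc n)
      ≡⟨ ∑-distrib-+ (λ i → fromℕ i * A i * B (n ∸ i)) (λ i → A i * (fromℕ (n ∸ i) * B (n ∸ i))) (suc n) ⟩
    ∑ (λ i → fromℕ i * A i * B (n ∸ i)) (suc n) + ∑ (λ i → A i * (fromℕ (n ∸ i) * B (n ∸ i))) (suc n)
      ≡⟨ sym (cong₂ _+_ (⊛-coeff (θ A) B n) (⊛-coeff A (θ B) n)) ⟩
    (θ A ⊛ B) n + (A ⊛ θ B) n ∎
    where
    open ≡-Reasoning
    leibniz : ∀ i → i ℕ.≤ n →
              fromℕ n * (A i * B (n ∸ i)) ≡ fromℕ i * A i * B (n ∸ i) + A i * (fromℕ (n ∸ i) * B (n ∸ i))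
    leibniz i i≤n = begin
      fromℕ n * (A i * B (n ∸ i))
        ≡⟨ cong (λ m → fromℕ m * (A i * B (n ∸ i))) (ℕ.m+[n∸m]≡n i≤n) ⟨
      fromℕ (i ℕ.+ (n ∸ i)) * (A i * B (n ∸ i))
        ≡⟨ cong (_* (A i * B (n ∸ i))) (fromℕ-+ i (n ∸ i)) ⟩
      (fromℕ i + fromℕ (n ∸ i)) * (A i * B (n ∸ i))
        ≡⟨ solve 4 (λ a b x y → (x :+ y) :* (a :* b) := x :* a :* b :+ a :* (y :* b))
             refl (A i) (B (n ∸ i)) (fromℕ i) (fromℕ (n ∸ i)) ⟩
      fromℕ i * A i * B (n ∸ i) + A i * (fromℕ (n ∸ i) * B (n ∸ i)) ∎

  θ-powS : ∀ A m → θ (powS A (suc m)) ≋ fromℕ (suc m) · (θ A ⊛ powS A m)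
  θ-powS A zero n = begin
    θ (A ⊛ oneS) n                       ≡⟨ θ-⊛ A oneS n ⟩
    (θ A ⊛ oneS) n + (A ⊛ θ oneS) n      ≡⟨ cong ((θ A ⊛ oneS) n +_) (trans (⊛-congʳ A θ-oneS n) (⊛-zeroʳ A n)) ⟩
    (θ A ⊛ oneS) n + 0ℚ                  ≡⟨ solve 1 (λ x → x :+ con 0ℚ := con 1ℚ :* x) refl ((θ A ⊛ oneS) n) ⟩
    1ℚ * (θ A ⊛ oneS) n                  ∎
    where open ≡-Reasoning
  θ-powS A (suc m) n = begin
    θ (A ⊛ Aᵐ⁺¹) n
      ≡⟨ θ-⊛ A Aᵐ⁺¹ n ⟩
    (θ A ⊛ Aᵐ⁺¹) n + (A ⊛ θ Aᵐ⁺¹) n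
      ≡⟨ cong ((θ A ⊛ Aᵐ⁺¹) n +_) (trans (⊛-congʳ A (θ-powS A m) n) (⊛-· (fromℕ (suc m)) A (θ A ⊛ powS A m) n)) ⟩
    (θ A ⊛ Aᵐ⁺¹) n + fromℕ (suc m) * (A ⊛ (θ A ⊛ powS A m)) n
      ≡⟨ cong (λ x → (θ A ⊛ Aᵐ⁺¹) n + fromℕ (suc m) * x) rotate ⟩
    (θ A ⊛ Aᵐ⁺¹) n + fromℕ (suc m) * (θ A ⊛ Aᵐ⁺¹) n
      ≡⟨ solve 2 (λ x y → x :+ y :* x := (con 1ℚ :+ y) :* x) refl ((θ A ⊛ Aᵐ⁺¹) n) (fromℕ (suc m)) ⟩
    (1ℚ + fromℕ (suc m)) * (θ A ⊛ Aᵐ⁺¹) n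
      ≡⟨ cong (_* (θ A ⊛ Aᵐ⁺¹) n) (sym (fromℕ-+ 1 (suc m))) ⟩
    fromℕ (suc (suc m)) * (θ A ⊛ Aᵐ⁺¹) n ∎
    where
    open ≡-Reasoning
    Aᵐ⁺¹ : Series
    Aᵐ⁺¹ = powS A (suc m)
    rotate : (A ⊛ (θ A ⊛ powS A m)) n ≡ (θ A ⊛ Aᵐ⁺¹) n
    rotate = trans (sym (⊛-assoc A (θ A) (powS A m) n))
               (trans (⊛-congˡ (powS A m) (⊛-comm A (θ A)) n) (⊛-assoc (θ A) A (powS A m) n))

  solve-fixpoint : ∀ {A B P Q} → A ≋ B ⊕ P ⊛ A → Q ⊛ (oneS ⊖ P) ≋ oneS → A ≋ B ⊛ Q
  solve-fixpoint {A} {B} {P} {Q} A≋B+PA Q[1-P]≋1 n = begin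
    A n                          ≡⟨ sym (⊛-identityʳ A n) ⟩
    (A ⊛ oneS) n                 ≡⟨ ⊛-congʳ A (λ m → trans (⊛-comm (oneS ⊖ P) Q m) (Q[1-P]≋1 m)) n ⟨
    (A ⊛ ((oneS ⊖ P) ⊛ Q)) n     ≡⟨ ⊛-assoc A (oneS ⊖ P) Q n ⟨
    ((A ⊛ (oneS ⊖ P)) ⊛ Q) n     ≡⟨ ⊛-congˡ Q A[1-P]≋B n ⟩
    (B ⊛ Q) n                    ∎
    where
    open ≡-Reasoning
    A[1-P]≋B : A ⊛ (oneS ⊖ P) ≋ B
    A[1-P]≋B m = begin
      (A ⊛ (oneS ⊖ P)) m          ≡⟨ ⊛-distribˡ-⊖ A oneS P m ⟩
      (A ⊛ oneS) m - (A ⊛ P) m    ≡⟨ cong₂ _-_ (trans (⊛-identityʳ A m) (A≋B+PA m)) (⊛-comm A P m) ⟩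
      B m + (P ⊛ A) m - (P ⊛ A) m ≡⟨ solve 2 (λ b x → b :+ x :- x := b) refl (B m) ((P ⊛ A) m) ⟩
      B m                         ∎

  ⪰-resp-≋ : ∀ {A A′ B} → A ≋ A′ → A ⪰ B → A′ ⪰ B
  ⪰-resp-≋ {B = B} A≋A′ A⪰B n = subst (B n ≤_) (A≋A′ n) (A⪰B n)

  ⊖⊕⪰0⇒⪰⊖ : ∀ {A B C} → (A ⊖ B ⊕ C) ⪰ zeroS → A ⪰ (B ⊖ C)
  ⊖⊕⪰0⇒⪰⊖ {A} {B} {C} A-B+C⪰0 n = 0≤q-p⇒p≤q (subst (0ℚ ≤_)
    (solve 3 (λ a b c → a :- b :+ c := a :- (b :- c)) refl (A n) (B n) (C n)) (A-B+C⪰0 n))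

  oneS-nonNeg : oneS ⪰ zeroS
  oneS-nonNeg zero    = 0≤fromℕ 1
  oneS-nonNeg (suc n) = ≤-refl

  ·-nonNeg : ∀ {q A} → 0ℚ ≤ q → A ⪰ zeroS → (q · A) ⪰ zeroS
  ·-nonNeg 0≤q A⪰0 n = 0≤* 0≤q (A⪰0 n)

  θ-nonNeg : ∀ {A} → A ⪰ zeroS → θ A ⪰ zeroS
  θ-nonNeg A⪰0 n = 0≤* (0≤fromℕ n) (A⪰0 n)

  ⊛-nonNeg : ∀ {A B} → A ⪰ zeroS → B ⪰ zeroS → (A ⊛ B) ⪰ zeroS
  ⊛-nonNeg {A} {B} A⪰0 B⪰0 n =
    subst (0ℚ ≤_) (sym (⊛-coeff A B n)) (0≤∑ (suc n) (λ i _ → 0≤* (A⪰0 i) (B⪰0 (n ∸ i))))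

  powS-nonNeg : ∀ {A} m → A ⪰ zeroS → powS A m ⪰ zeroS
  powS-nonNeg zero    A⪰0 = oneS-nonNeg
  powS-nonNeg (suc m) A⪰0 = ⊛-nonNeg A⪰0 (powS-nonNeg m A⪰0)

  ⊛-lowerBound : ∀ {X Y A B C D} → X ⪰ zeroS → Y ⪰ zeroS →
    A ⪰ zeroS → B ⪰ zeroS → C ⪰ zeroS → D ⪰ zeroS → X ⪰ (A ⊖ B) → Y ⪰ (C ⊖ D) →
    (X ⊛ Y) ⪰ (A ⊛ C ⊖ A ⊛ D ⊖ B ⊛ C)
  ⊛-lowerBound {X} {Y} {A} {B} {C} {D} X⪰0 Y⪰0 A⪰0 B⪰0 C⪰0 D⪰0 X⪰A-B Y⪰C-D n = begin
    (A ⊛ C) n - (A ⊛ D) n - (B ⊛ C) n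
      ≡⟨ cong₂ _-_ (cong₂ _-_ (⊛-coeff A C n) (⊛-coeff A D n)) (⊛-coeff B C n) ⟩
    ∑ ac (suc n) - ∑ ad (suc n) - ∑ bc (suc n)
      ≡⟨ cong (λ x → x - ∑ bc (suc n)) (∑-distrib-minus ac ad (suc n)) ⟨
    ∑ (λ i → ac i - ad i) (suc n) - ∑ bc (suc n)
      ≡⟨ ∑-distrib-minus (λ i → ac i - ad i) bc (suc n) ⟨
    ∑ (λ i → ac i - ad i - bc i) (suc n)
      ≤⟨ ∑-mono-≤ (suc n) (λ i _ → a-b≤x∧c-d≤y⇒ac-ad-bc≤xy (X⪰0 i) (Y⪰0 (n ∸ i))
           (A⪰0 i) (B⪰0 i) (C⪰0 (n ∸ i)) (D⪰0 (n ∸ i)) (X⪰A-B i) (Y⪰C-D (n ∸ i))) ⟩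
    ∑ (λ i → X i * Y (n ∸ i)) (suc n)
      ≡⟨ ⊛-coeff X Y n ⟨
    (X ⊛ Y) n ∎
    where
    open ≤-Reasoning
    ac ad bc : ℕ → ℚ
    ac i = A i * C (n ∸ i)
    ad i = A i * D (n ∸ i)
    bc i = B i * C (n ∸ i)

  scaled-⊛-scaled : ∀ q r S P a b →
    (q · (S ⊛ powS P a)) ⊛ (r · (S ⊛ powS P b)) ≋ (q * r) · (powS S 2 ⊛ powS P (a ℕ.+ b))
  scaled-⊛-scaled q r S P a b n = begin
    ((q · (S ⊛ Pᵃ)) ⊛ (r · (S ⊛ Pᵇ))) n    ≡⟨ ·-⊛ q (S ⊛ Pᵃ) (r · (S ⊛ Pᵇ)) n ⟩
    q * ((S ⊛ Pᵃ) ⊛ (r · (S ⊛ Pᵇ))) n      ≡⟨ cong (q *_) (⊛-· r (S ⊛ Pᵃ) (S ⊛ Pᵇ) n) ⟩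
    q * (r * ((S ⊛ Pᵃ) ⊛ (S ⊛ Pᵇ)) n)      ≡⟨ *-assoc q r _ ⟨
    q * r * ((S ⊛ Pᵃ) ⊛ (S ⊛ Pᵇ)) n        ≡⟨ cong (q * r *_) (regroup n) ⟩
    q * r * (powS S 2 ⊛ powS P (a ℕ.+ b)) n ∎
    where
    open ≡-Reasoning
    Pᵃ Pᵇ : Series
    Pᵃ = powS P a
    Pᵇ = powS P b
    regroup : (S ⊛ Pᵃ) ⊛ (S ⊛ Pᵇ) ≋ powS S 2 ⊛ powS P (a ℕ.+ b)
    regroup m = begin
      ((S ⊛ Pᵃ) ⊛ (S ⊛ Pᵇ)) m       ≡⟨ ⊛-assoc S Pᵃ (S ⊛ Pᵇ) m ⟩
      (S ⊛ (Pᵃ ⊛ (S ⊛ Pᵇ))) m       ≡⟨ ⊛-congʳ S (λ j → trans (sym (⊛-assoc Pᵃ S Pᵇ j))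
                                          (trans (⊛-congˡ Pᵇ (⊛-comm Pᵃ S) j) (⊛-assoc S Pᵃ Pᵇ j))) m ⟩
      (S ⊛ (S ⊛ (Pᵃ ⊛ Pᵇ))) m       ≡⟨ ⊛-congʳ S (⊛-congʳ S (λ j → sym (powS-+ P a b j))) m ⟩
      (S ⊛ (S ⊛ powS P (a ℕ.+ b))) m ≡⟨ ⊛-congʳ S (⊛-congˡ (powS P (a ℕ.+ b)) (⊛-identityʳ S)) m ⟨
      (S ⊛ ((S ⊛ oneS) ⊛ powS P (a ℕ.+ b))) m ≡⟨ ⊛-assoc S (S ⊛ oneS) (powS P (a ℕ.+ b)) m ⟨
      (powS S 2 ⊛ powS P (a ℕ.+ b)) m ∎

module ExponentialSeries where

  open import Defs using (Series; _⊕_; _·_; _⊛_; oneS; θ; fromℕ)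
  open NatEmbedding
  open PowerSeries
  open import Data.Nat as ℕ using (ℕ; zero; suc; s≤s; _<_; _!)
  import Data.Nat.Properties as ℕ
  import Data.Integer as ℤ
  open import Data.Rational using (ℚ; 0ℚ; 1ℚ; _+_; _*_; -_; _/_)
  open import Data.Rational.Properties
  open import Algebra.Bundles using (CommutativeRing)
  open import Algebra.Properties.CommutativeSemiring.Exp (CommutativeRing.commutativeSemiring +-*-commutativeRing)
    using (_^_; ^-homo-*; ^-distrib-*)
  open import Relation.Binary.PropositionalEquality
  open import Data.Rational.Solver using (module +-*-Solver)
  open +-*-Solver

  fromℕ-^ : ∀ m n → fromℕ (m ℕ.^ n) ≡ fromℕ m ^ n
  fromℕ-^ m zero    = refl
  fromℕ-^ m (suc n) = trans (fromℕ-* m (m ℕ.^ n)) (cong (fromℕ m *_) (fromℕ-^ m n))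

  1^n≡1 : ∀ n → 1ℚ ^ n ≡ 1ℚ
  1^n≡1 zero    = refl
  1^n≡1 (suc n) = trans (*-identityˡ (1ℚ ^ n)) (1^n≡1 n)

  1/! : ℕ → ℚ
  1/! n = (ℤ.+ 1 / n !) {{n ℕ.!≢0}}

  n!*1/!n≡1 : ∀ n → fromℕ (n !) * 1/! n ≡ 1ℚ
  n!*1/!n≡1 n = fromℕ-*-/ 1 (n !) {{n ℕ.!≢0}}

  [1+n]*1/![1+n] : ∀ n → fromℕ (suc n) * 1/! (suc n) ≡ 1/! n
  [1+n]*1/![1+n] n = fromℕ-cancelˡ (n !) {{n ℕ.!≢0}} (begin
    fromℕ (n !) * (fromℕ (suc n) * 1/! (suc n))  ≡⟨ *-assoc (fromℕ (n !)) _ _ ⟨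
    fromℕ (n !) * fromℕ (suc n) * 1/! (suc n)    ≡⟨ cong (_* 1/! (suc n)) (fromℕ-* (n !) (suc n)) ⟨
    fromℕ (n ! ℕ.* suc n) * 1/! (suc n)          ≡⟨ cong (λ m → fromℕ m * 1/! (suc n)) (ℕ.*-comm (n !) (suc n)) ⟩
    fromℕ (suc n !) * 1/! (suc n)                ≡⟨ n!*1/!n≡1 (suc n) ⟩
    1ℚ                                           ≡⟨ n!*1/!n≡1 n ⟨
    fromℕ (n !) * 1/! n                          ∎)
    where open ≡-Reasoning

  expS : ℚ → Series
  expS y n = y ^ n * 1/! n

  zS : Series
  zS zero    = 0ℚ
  zS (suc n) = oneS n

  zS-⊛-0 : ∀ A → (zS ⊛ A) 0 ≡ 0ℚ
  zS-⊛-0 A = trans (⊛-coeff-0 zS A) (*-zeroˡ (A 0))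

  zS-⊛-suc : ∀ A n → (zS ⊛ A) (suc n) ≡ A n
  zS-⊛-suc A n = trans (⊛-coeff-suc zS A n)
    (trans (cong₂ _+_ (*-zeroˡ (A (suc n))) (⊛-identityˡ A n)) (+-identityˡ (A n)))

  ∂ : Series → Series
  ∂ A = tailS (θ A)

  ∂-⊛ : ∀ A B → ∂ (A ⊛ B) ≋ ∂ A ⊛ B ⊕ A ⊛ ∂ B
  ∂-⊛ A B n = begin
    θ (A ⊛ B) (suc n)                          ≡⟨ θ-⊛ A B (suc n) ⟩
    (θ A ⊛ B) (suc n) + (A ⊛ θ B) (suc n)      ≡⟨ cong ((θ A ⊛ B) (suc n) +_) (⊛-comm A (θ B) (suc n)) ⟩
    (θ A ⊛ B) (suc n) + (θ B ⊛ A) (suc n)      ≡⟨ cong₂ _+_ (shift A B) (trans (shift B A) (⊛-comm (∂ B) A n)) ⟩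
    (∂ A ⊛ B) n + (A ⊛ ∂ B) n                  ∎
    where
    open ≡-Reasoning
    shift : ∀ A B → (θ A ⊛ B) (suc n) ≡ (∂ A ⊛ B) n
    shift A B = trans (⊛-coeff-suc (θ A) B n)
      (trans (cong (_+ (∂ A ⊛ B) n) (trans (cong (_* B (suc n)) (*-zeroˡ (A 0))) (*-zeroˡ (B (suc n)))))
             (+-identityˡ ((∂ A ⊛ B) n)))

  ∂-expS : ∀ y → ∂ (expS y) ≋ y · expS y
  ∂-expS y n = begin
    fromℕ (suc n) * (y * y ^ n * 1/! (suc n))  ≡⟨ solve 4 (λ a b c d → a :* (b :* c :* d) := b :* c :* (a :* d))
                                                    refl (fromℕ (suc n)) y (y ^ n) (1/! (suc n)) ⟩
    y * y ^ n * (fromℕ (suc n) * 1/! (suc n))  ≡⟨ cong (y * y ^ n *_) ([1+n]*1/![1+n] n) ⟩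
    y * y ^ n * 1/! n                          ≡⟨ *-assoc y (y ^ n) (1/! n) ⟩
    y * (y ^ n * 1/! n)                        ∎
    where open ≡-Reasoning

  ∂-unique : ∀ y {F G} → ∂ F ≋ y · F → ∂ G ≋ y · G → F 0 ≡ G 0 → F ≋ G
  ∂-unique y ∂F≋yF ∂G≋yG F₀≡G₀ zero    = F₀≡G₀
  ∂-unique y ∂F≋yF ∂G≋yG F₀≡G₀ (suc n) = fromℕ-cancelˡ (suc n)
    (trans (∂F≋yF n) (trans (cong (y *_) (∂-unique y ∂F≋yF ∂G≋yG F₀≡G₀ n)) (sym (∂G≋yG n))))

  expS-+ : ∀ y w → expS y ⊛ expS w ≋ expS (y + w)
  expS-+ y w = ∂-unique (y + w) ∂[EyEw] (∂-expS (y + w)) (⊛-coeff-0 (expS y) (expS w))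
    where
    ∂[EyEw] : ∂ (expS y ⊛ expS w) ≋ (y + w) · (expS y ⊛ expS w)
    ∂[EyEw] n = begin
      ∂ (expS y ⊛ expS w) n
        ≡⟨ ∂-⊛ (expS y) (expS w) n ⟩
      (∂ (expS y) ⊛ expS w) n + (expS y ⊛ ∂ (expS w)) n
        ≡⟨ cong₂ _+_ (trans (⊛-congˡ (expS w) (∂-expS y) n) (·-⊛ y (expS y) (expS w) n))
                     (trans (⊛-congʳ (expS y) (∂-expS w) n) (⊛-· w (expS y) (expS w) n)) ⟩
      y * (expS y ⊛ expS w) n + w * (expS y ⊛ expS w) n
        ≡⟨ *-distribʳ-+ _ y w ⟨
      (y + w) * (expS y ⊛ expS w) n ∎
      where open ≡-Reasoning

  expS-0 : expS 0ℚ ≋ oneS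
  expS-0 zero    = refl
  expS-0 (suc n) = trans (cong (_* 1/! (suc n)) (*-zeroˡ (0ℚ ^ n))) (*-zeroˡ (1/! (suc n)))

  θ-expS : ∀ y → θ (expS y) ≋ y · (zS ⊛ expS y)
  θ-expS y zero    = trans (*-zeroˡ (expS y 0)) (sym (trans (cong (y *_) (zS-⊛-0 (expS y))) (*-zeroʳ y)))
  θ-expS y (suc n) = trans (∂-expS y n) (cong (y *_) (sym (zS-⊛-suc (expS y) n)))

  powerExp : ℕ → Series
  powerExp p k = fromℕ k ^ p * 1/! k

  -- The Touchard polynomials; note powerExp p = θᵖ eᶻ.
  touchard : ℕ → Series
  touchard zero    = oneS
  touchard (suc p) = θ (touchard p) ⊕ zS ⊛ touchard p

  powerExp≋touchard⊛expS : ∀ p → powerExp p ≋ touchard p ⊛ expS 1ℚ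
  powerExp≋touchard⊛expS zero k = begin
    1ℚ * 1/! k            ≡⟨ cong (_* 1/! k) (sym (1^n≡1 k)) ⟩
    expS 1ℚ k             ≡⟨ ⊛-identityˡ (expS 1ℚ) k ⟨
    (oneS ⊛ expS 1ℚ) k    ∎
    where open ≡-Reasoning
  powerExp≋touchard⊛expS (suc p) k = begin
    fromℕ k * fromℕ k ^ p * 1/! k
      ≡⟨ *-assoc (fromℕ k) (fromℕ k ^ p) (1/! k) ⟩
    θ (powerExp p) k
      ≡⟨ θ-cong (powerExp≋touchard⊛expS p) k ⟩
    θ (Q ⊛ E) k
      ≡⟨ θ-⊛ Q E k ⟩
    (θ Q ⊛ E) k + (Q ⊛ θ E) k
      ≡⟨ cong ((θ Q ⊛ E) k +_) (trans (⊛-congʳ Q (θ-expS 1ℚ) k) (trans (⊛-· 1ℚ Q (zS ⊛ E) k) (*-identityˡ _))) ⟩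
    (θ Q ⊛ E) k + (Q ⊛ (zS ⊛ E)) k
      ≡⟨ cong ((θ Q ⊛ E) k +_) (trans (sym (⊛-assoc Q zS E k)) (⊛-congˡ E (⊛-comm Q zS) k)) ⟩
    (θ Q ⊛ E) k + ((zS ⊛ Q) ⊛ E) k
      ≡⟨ ⊛-distribʳ-⊕ E (θ Q) (zS ⊛ Q) k ⟨
    (touchard (suc p) ⊛ E) k ∎
    where
    open ≡-Reasoning
    Q E : Series
    Q = touchard p
    E = expS 1ℚ

  touchard-vanish : ∀ p m → p < m → touchard p m ≡ 0ℚ
  touchard-vanish zero    (suc m) _         = refl
  touchard-vanish (suc p) (suc m) (s≤s p<m) = begin
    fromℕ (suc m) * touchard p (suc m) + (zS ⊛ touchard p) (suc m)
      ≡⟨ cong₂ _+_ (cong (fromℕ (suc m) *_) (touchard-vanish p (suc m) (ℕ.m<n⇒m<1+n p<m)))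
                   (trans (zS-⊛-suc (touchard p) m) (touchard-vanish p m p<m)) ⟩
    fromℕ (suc m) * 0ℚ + 0ℚ
      ≡⟨ solve 1 (λ x → x :* con 0ℚ :+ con 0ℚ := con 0ℚ) refl (fromℕ (suc m)) ⟩
    0ℚ ∎
    where open ≡-Reasoning

  powerExp⊛expS[-1]-vanish : ∀ p m → p < m → (powerExp p ⊛ expS (- 1ℚ)) m ≡ 0ℚ
  powerExp⊛expS[-1]-vanish p m p<m = begin
    (powerExp p ⊛ expS (- 1ℚ)) m                  ≡⟨ ⊛-congˡ (expS (- 1ℚ)) (powerExp≋touchard⊛expS p) m ⟩
    ((touchard p ⊛ expS 1ℚ) ⊛ expS (- 1ℚ)) m      ≡⟨ ⊛-assoc (touchard p) (expS 1ℚ) (expS (- 1ℚ)) m ⟩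
    (touchard p ⊛ (expS 1ℚ ⊛ expS (- 1ℚ))) m      ≡⟨ ⊛-congʳ (touchard p) e¹e⁻¹≋1 m ⟩
    (touchard p ⊛ oneS) m                          ≡⟨ ⊛-identityʳ (touchard p) m ⟩
    touchard p m                                   ≡⟨ touchard-vanish p m p<m ⟩
    0ℚ                                             ∎
    where
    open ≡-Reasoning
    e¹e⁻¹≋1 : expS 1ℚ ⊛ expS (- 1ℚ) ≋ oneS
    e¹e⁻¹≋1 n = trans (expS-+ 1ℚ (- 1ℚ) n) (trans (cong (λ y → expS y n) (+-inverseʳ 1ℚ)) (expS-0 n))

module TreeFunction where

  open import Defs using (Series; _⊕_; _⊖_; _·_; _⊛_; _⪰_; oneS; zeroS; powS; θ; fromℕ; Tz; inv1mT; invPow; oneMinusT)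
  open NatEmbedding
  open FiniteSums
  open PowerSeries
  open ExponentialSeries
  open import Data.Nat as ℕ using (ℕ; zero; suc; _∸_; s≤s; _!)
  import Data.Nat.Properties as ℕ
  open import Data.Rational using (ℚ; 0ℚ; 1ℚ; _+_; _*_; _-_; -_; _≤_)
  open import Data.Rational.Properties
  open import Algebra.Bundles using (CommutativeRing)
  open import Algebra.Properties.CommutativeSemiring.Exp (CommutativeRing.commutativeSemiring +-*-commutativeRing)
    using (_^_; ^-homo-*; ^-distrib-*)
  open import Relation.Binary.PropositionalEquality
  open import Data.Rational.Solver using (module +-*-Solver)
  open +-*-Solver

  Tz-suc : ∀ k → Tz (suc k) ≡ fromℕ (suc k) ^ k * 1/! (suc k)
  Tz-suc k = trans (/-as-* (suc k ℕ.^ k) (suc k !) {{suc k ℕ.!≢0}})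
                   (cong (_* 1/! (suc k)) (fromℕ-^ (suc k) k))

  -- treeCompose is T(z e⁻ᶻ), so treeCompose≋zS is the functional equation T = z eᵀ.
  treeCompose : Series
  treeCompose m = ∑ (λ k → Tz k * expS (- fromℕ k) (m ∸ k)) (suc m)

  treeCompose≋zS : treeCompose ≋ zS
  treeCompose≋zS zero                = refl
  treeCompose≋zS (suc zero)          = refl
  treeCompose≋zS (suc (suc p′)) = begin
    ∑ (λ k → Tz k * expS (- fromℕ k) (m ∸ k)) (suc m)
      ≡⟨ ∑-cong (suc m) (λ k k<1+m → term k (ℕ.≤-pred k<1+m)) ⟩
    ∑ (λ k → powerExp p k * expS (- 1ℚ) (m ∸ k)) (suc m)
      ≡⟨ ⊛-coeff (powerExp p) (expS (- 1ℚ)) m ⟨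
    (powerExp p ⊛ expS (- 1ℚ)) m
      ≡⟨ powerExp⊛expS[-1]-vanish p m (ℕ.n<1+n p) ⟩
    0ℚ ∎
    where
    open ≡-Reasoning
    p m : ℕ
    p = suc p′
    m = suc p
    term : ∀ k → k ℕ.≤ m → Tz k * expS (- fromℕ k) (m ∸ k) ≡ powerExp p k * expS (- 1ℚ) (m ∸ k)
    term zero _ = trans (*-zeroˡ (expS 0ℚ m))
      (solve 3 (λ a b c → con 0ℚ := con 0ℚ :* a :* b :* c) refl (0ℚ ^ p′) (1/! 0) (expS (- 1ℚ) m))
    term (suc k) (s≤s k≤p) = begin
      Tz (suc k) * ((- x) ^ e * 1/! e)
        ≡⟨ cong₂ (λ a b → a * (b * 1/! e)) (Tz-suc k)
                 (trans (cong (_^ e) (solve 1 (λ x → :- x := :- con 1ℚ :* x) refl x)) (^-distrib-* (- 1ℚ) x e)) ⟩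
      x ^ k * 1/! (suc k) * ((- 1ℚ) ^ e * x ^ e * 1/! e)
        ≡⟨ solve 5 (λ a b c d f → a :* b :* (c :* d :* f) := a :* d :* b :* (c :* f))
             refl (x ^ k) (1/! (suc k)) ((- 1ℚ) ^ e) (x ^ e) (1/! e) ⟩
      x ^ k * x ^ e * 1/! (suc k) * ((- 1ℚ) ^ e * 1/! e)
        ≡⟨ cong (λ a → a * 1/! (suc k) * ((- 1ℚ) ^ e * 1/! e)) (sym (^-homo-* x k e)) ⟩
      x ^ (k ℕ.+ e) * 1/! (suc k) * ((- 1ℚ) ^ e * 1/! e)
        ≡⟨ cong (λ j → x ^ j * 1/! (suc k) * ((- 1ℚ) ^ e * 1/! e)) (ℕ.m+[n∸m]≡n k≤p) ⟩
      x ^ p * 1/! (suc k) * ((- 1ℚ) ^ e * 1/! e) ∎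
      where
      x : ℚ
      x = fromℕ (suc k)
      e : ℕ
      e = p ∸ k

  [oneS⊕θTz]≡expS : ∀ j → (oneS ⊕ θ Tz) j ≡ expS (fromℕ j) j
  [oneS⊕θTz]≡expS zero    = refl
  [oneS⊕θTz]≡expS (suc k) = begin
    0ℚ + x * Tz (suc k)             ≡⟨ +-identityˡ _ ⟩
    x * Tz (suc k)                  ≡⟨ cong (x *_) (Tz-suc k) ⟩
    x * (x ^ k * 1/! (suc k))       ≡⟨ *-assoc x (x ^ k) (1/! (suc k)) ⟨
    x * x ^ k * 1/! (suc k)         ∎
    where
    open ≡-Reasoning
    x : ℚ
    x = fromℕ (suc k)

  θTz≋Tz⊛[oneS⊕θTz] : θ Tz ≋ Tz ⊛ (oneS ⊕ θ Tz)
  θTz≋Tz⊛[oneS⊕θTz] zero    = refl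
  θTz≋Tz⊛[oneS⊕θTz] (suc N) = begin
    θ Tz n
      ≡⟨ trans (sym (+-identityˡ (θ Tz n))) ([oneS⊕θTz]≡expS n) ⟩
    expS x n
      ≡⟨ solve 3 (λ x a b → x :* a :* b := a :* (x :* b)) refl x (x ^ N) (1/! n) ⟩
    x ^ N * (x * 1/! n)
      ≡⟨ cong (x ^ N *_) ([1+n]*1/![1+n] N) ⟩
    expS x N
      ≡⟨ zS-⊛-suc (expS x) N ⟨
    (zS ⊛ expS x) n
      ≡⟨ trans (⊛-congʳ (expS x) treeCompose≋zS n) (⊛-comm (expS x) zS n) ⟨
    (expS x ⊛ treeCompose) n
      ≡⟨ ⊛-coeff (expS x) treeCompose n ⟩
    ∑ (λ j → expS x j * treeCompose (n ∸ j)) (suc n)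
      ≡⟨ ∑-cong (suc n) (λ j _ → expand j) ⟩
    ∑ (λ j → ∑ (λ k → f k j) (suc (n ∸ j))) (suc n)
      ≡⟨ ∑-triangle-swap f n ⟨
    ∑ (λ k → ∑ (f k) (suc (n ∸ k))) (suc n)
      ≡⟨ ∑-cong (suc n) (λ k k<1+n → collapse k (ℕ.≤-pred k<1+n)) ⟩
    ∑ (λ k → Tz k * (oneS ⊕ θ Tz) (n ∸ k)) (suc n)
      ≡⟨ ⊛-coeff Tz (oneS ⊕ θ Tz) n ⟨
    (Tz ⊛ (oneS ⊕ θ Tz)) n ∎
    where
    open ≡-Reasoning
    n : ℕ
    n = suc N
    x : ℚ
    x = fromℕ n
    f : ℕ → ℕ → ℚ
    f k j = Tz k * (expS x j * expS (- fromℕ k) (n ∸ k ∸ j))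

    expand : ∀ j → expS x j * treeCompose (n ∸ j) ≡ ∑ (λ k → f k j) (suc (n ∸ j))
    expand j = trans (sym (∑-*ˡ (expS x j) (λ k → Tz k * expS (- fromℕ k) (n ∸ j ∸ k)) (suc (n ∸ j))))
                     (∑-cong (suc (n ∸ j)) (λ k _ → reorder k))
      where
      reorder : ∀ k → expS x j * (Tz k * expS (- fromℕ k) (n ∸ j ∸ k)) ≡ f k j
      reorder k = trans (solve 3 (λ a b c → a :* (b :* c) := b :* (a :* c))
                               refl (expS x j) (Tz k) (expS (- fromℕ k) (n ∸ j ∸ k)))
                        (cong (λ i → Tz k * (expS x j * expS (- fromℕ k) i)) n∸j∸k≡n∸k∸j)
        where
        n∸j∸k≡n∸k∸j : n ∸ j ∸ k ≡ n ∸ k ∸ j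
        n∸j∸k≡n∸k∸j = trans (ℕ.∸-+-assoc n j k) (trans (cong (n ∸_) (ℕ.+-comm j k)) (sym (ℕ.∸-+-assoc n k j)))

    collapse : ∀ k → k ℕ.≤ n → ∑ (f k) (suc (n ∸ k)) ≡ Tz k * (oneS ⊕ θ Tz) (n ∸ k)
    collapse k k≤n = begin
      ∑ (f k) (suc (n ∸ k))
        ≡⟨ ∑-*ˡ (Tz k) (λ j → expS x j * expS (- fromℕ k) (n ∸ k ∸ j)) (suc (n ∸ k)) ⟩
      Tz k * ∑ (λ j → expS x j * expS (- fromℕ k) (n ∸ k ∸ j)) (suc (n ∸ k))
        ≡⟨ cong (Tz k *_) (⊛-coeff (expS x) (expS (- fromℕ k)) (n ∸ k)) ⟨
      Tz k * (expS x ⊛ expS (- fromℕ k)) (n ∸ k)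
        ≡⟨ cong (Tz k *_) (expS-+ x (- fromℕ k) (n ∸ k)) ⟩
      Tz k * expS (x - fromℕ k) (n ∸ k)
        ≡⟨ cong (λ y → Tz k * expS y (n ∸ k)) (fromℕ-∸ k≤n) ⟨
      Tz k * expS (fromℕ (n ∸ k)) (n ∸ k)
        ≡⟨ cong (Tz k *_) ([oneS⊕θTz]≡expS (n ∸ k)) ⟨
      Tz k * (oneS ⊕ θ Tz) (n ∸ k) ∎

  Tz-nonNeg : Tz ⪰ zeroS
  Tz-nonNeg zero    = ≤-refl
  Tz-nonNeg (suc n) = 0≤/ (suc n ℕ.^ n) (suc n !) {{suc n ℕ.!≢0}}

  inv1mT-coeff : ∀ n → inv1mT n ≡ ∑ (λ j → powS Tz j n) (suc n)
  inv1mT-coeff n = sumℚ-map-upTo (λ j → powS Tz j n) (suc n)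

  inv1mT-nonNeg : inv1mT ⪰ zeroS
  inv1mT-nonNeg n = subst (0ℚ ≤_) (sym (inv1mT-coeff n))
    (0≤∑ (suc n) (λ j _ → powS-nonNeg j Tz-nonNeg n))

  invPow-nonNeg : ∀ m → invPow m ⪰ zeroS
  invPow-nonNeg m = powS-nonNeg m inv1mT-nonNeg

  inv1mT-coeff-extend : ∀ {m N} → m ℕ.≤ N → inv1mT m ≡ ∑ (λ j → powS Tz j m) (suc N)
  inv1mT-coeff-extend {m} {N} m≤N = begin
    inv1mT m
      ≡⟨ inv1mT-coeff m ⟩
    ∑ (λ j → powS Tz j m) (suc m)
      ≡⟨ ∑-extend {f = λ j → powS Tz j m} (suc m) (N ∸ m) (λ _ _ → refl)
           (λ i → powS-vanish Tz refl (suc m ℕ.+ i) m (s≤s (ℕ.m≤m+n m i))) ⟩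
    ∑ (λ j → powS Tz j m) (suc m ℕ.+ (N ∸ m))
      ≡⟨ cong (λ i → ∑ (λ j → powS Tz j m) (suc i)) (ℕ.m+[n∸m]≡n m≤N) ⟩
    ∑ (λ j → powS Tz j m) (suc N) ∎
    where open ≡-Reasoning

  inv1mT-fixpoint : inv1mT ≋ oneS ⊕ Tz ⊛ inv1mT
  inv1mT-fixpoint n = begin
    inv1mT n                   ≡⟨ inv1mT-coeff n ⟩
    oneS n + ∑ Tʲ⁺¹ n          ≡⟨ cong (oneS n +_) drop-vanishing-last ⟨
    oneS n + ∑ Tʲ⁺¹ (suc n)    ≡⟨ cong (oneS n +_) Tz⊛inv1mT ⟨
    oneS n + (Tz ⊛ inv1mT) n   ∎
    where
    open ≡-Reasoning
    Tʲ⁺¹ : ℕ → ℚ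
    Tʲ⁺¹ j = powS Tz (suc j) n

    drop-vanishing-last : ∑ Tʲ⁺¹ (suc n) ≡ ∑ Tʲ⁺¹ n
    drop-vanishing-last = trans (∑-last Tʲ⁺¹ n)
      (trans (cong (∑ Tʲ⁺¹ n +_) (powS-vanish Tz refl (suc n) n (ℕ.n<1+n n))) (+-identityʳ (∑ Tʲ⁺¹ n)))

    Tz⊛inv1mT : (Tz ⊛ inv1mT) n ≡ ∑ Tʲ⁺¹ (suc n)
    Tz⊛inv1mT = begin
      (Tz ⊛ inv1mT) n
        ≡⟨ ⊛-coeff Tz inv1mT n ⟩
      ∑ (λ i → Tz i * inv1mT (n ∸ i)) (suc n)
        ≡⟨ ∑-cong (suc n) (λ i _ → trans (cong (Tz i *_) (inv1mT-coeff-extend (ℕ.m∸n≤m n i)))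
                                        (sym (∑-*ˡ (Tz i) (λ j → powS Tz j (n ∸ i)) (suc n)))) ⟩
      ∑ (λ i → ∑ (λ j → Tz i * powS Tz j (n ∸ i)) (suc n)) (suc n)
        ≡⟨ ∑-swap (λ i j → Tz i * powS Tz j (n ∸ i)) (suc n) (suc n) ⟩
      ∑ (λ j → ∑ (λ i → Tz i * powS Tz j (n ∸ i)) (suc n)) (suc n)
        ≡⟨ ∑-cong (suc n) (λ j _ → sym (⊛-coeff Tz (powS Tz j) n)) ⟩
      ∑ Tʲ⁺¹ (suc n) ∎

  inv1mT⊛oneMinusT : inv1mT ⊛ oneMinusT ≋ oneS
  inv1mT⊛oneMinusT n = begin
    (inv1mT ⊛ (oneS ⊖ Tz)) n
      ≡⟨ ⊛-distribˡ-⊖ inv1mT oneS Tz n ⟩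
    (inv1mT ⊛ oneS) n - (inv1mT ⊛ Tz) n
      ≡⟨ cong₂ _-_ (trans (⊛-identityʳ inv1mT n) (inv1mT-fixpoint n)) (⊛-comm inv1mT Tz n) ⟩
    oneS n + (Tz ⊛ inv1mT) n - (Tz ⊛ inv1mT) n
      ≡⟨ solve 2 (λ a b → a :+ b :- b := a) refl (oneS n) ((Tz ⊛ inv1mT) n) ⟩
    oneS n ∎
    where open ≡-Reasoning

  θTz≋Tz⊛inv1mT : θ Tz ≋ Tz ⊛ inv1mT
  θTz≋Tz⊛inv1mT = solve-fixpoint {B = Tz} {P = Tz} {Q = inv1mT} θTz≋Tz⊕Tz⊛θTz inv1mT⊛oneMinusT
    where
    θTz≋Tz⊕Tz⊛θTz : θ Tz ≋ Tz ⊕ Tz ⊛ θ Tz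
    θTz≋Tz⊕Tz⊛θTz n = trans (θTz≋Tz⊛[oneS⊕θTz] n)
      (trans (⊛-distribˡ-⊕ Tz oneS (θ Tz) n) (cong (_+ (Tz ⊛ θ Tz) n) (⊛-identityʳ Tz n)))

  θ-inv1mT : θ inv1mT ≋ Tz ⊛ invPow 3
  θ-inv1mT n = begin
    θ inv1mT n
      ≡⟨ solve-fixpoint {B = θ Tz ⊛ inv1mT} {P = Tz} {Q = inv1mT} θI≋θT⊛I⊕T⊛θI inv1mT⊛oneMinusT n ⟩
    ((θ Tz ⊛ inv1mT) ⊛ inv1mT) n
      ≡⟨ ⊛-congˡ inv1mT (⊛-congˡ inv1mT θTz≋Tz⊛inv1mT) n ⟩
    (((Tz ⊛ inv1mT) ⊛ inv1mT) ⊛ inv1mT) n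
      ≡⟨ trans (⊛-assoc (Tz ⊛ inv1mT) inv1mT inv1mT n) (⊛-assoc Tz inv1mT (inv1mT ⊛ inv1mT) n) ⟩
    (Tz ⊛ (inv1mT ⊛ (inv1mT ⊛ inv1mT))) n
      ≡⟨ ⊛-congʳ Tz (⊛-congʳ inv1mT (⊛-congʳ inv1mT (⊛-identityʳ inv1mT))) n ⟨
    (Tz ⊛ invPow 3) n ∎
    where
    open ≡-Reasoning
    θI≋θT⊛I⊕T⊛θI : θ inv1mT ≋ θ Tz ⊛ inv1mT ⊕ Tz ⊛ θ inv1mT
    θI≋θT⊛I⊕T⊛θI m = begin
      θ inv1mT m                               ≡⟨ θ-cong inv1mT-fixpoint m ⟩
      θ (oneS ⊕ Tz ⊛ inv1mT) m                 ≡⟨ θ-⊕ oneS (Tz ⊛ inv1mT) m ⟩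
      θ oneS m + θ (Tz ⊛ inv1mT) m             ≡⟨ cong₂ _+_ (θ-oneS m) (θ-⊛ Tz inv1mT m) ⟩
      0ℚ + (θ Tz ⊛ inv1mT ⊕ Tz ⊛ θ inv1mT) m   ≡⟨ +-identityˡ _ ⟩
      (θ Tz ⊛ inv1mT ⊕ Tz ⊛ θ inv1mT) m        ∎

  θ-invPow : ∀ m → 1 ℕ.≤ m → θ (invPow m) ≋ fromℕ m · (Tz ⊛ invPow (m ℕ.+ 2))
  θ-invPow (suc m) _ n = begin
    θ (invPow (suc m)) n
      ≡⟨ θ-powS inv1mT m n ⟩
    fromℕ (suc m) * (θ inv1mT ⊛ invPow m) n
      ≡⟨ cong (fromℕ (suc m) *_) (⊛-congˡ (invPow m) θ-inv1mT n) ⟩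
    fromℕ (suc m) * ((Tz ⊛ invPow 3) ⊛ invPow m) n
      ≡⟨ cong (fromℕ (suc m) *_) (⊛-assoc Tz (invPow 3) (invPow m) n) ⟩
    fromℕ (suc m) * (Tz ⊛ (invPow 3 ⊛ invPow m)) n
      ≡⟨ cong (fromℕ (suc m) *_) (⊛-congʳ Tz (powS-+ inv1mT 3 m) n) ⟨
    fromℕ (suc m) * (Tz ⊛ invPow (3 ℕ.+ m)) n
      ≡⟨ cong (λ i → fromℕ (suc m) * (Tz ⊛ invPow (suc i)) n) (ℕ.+-comm 2 m) ⟩
    fromℕ (suc m) * (Tz ⊛ invPow (suc m ℕ.+ 2)) n ∎
    where open ≡-Reasoning

module WrightConstants where

  open import Defs using (Σ₁; get; step; bc; b; c; cξ; rξ; Graph)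
  open NatEmbedding
  open RationalOrder
  open FiniteSums
  open import Data.Nat as ℕ using (ℕ; zero; suc; _∸_)
  open import Data.Rational using (ℚ; 0ℚ; _≤_)
  open import Data.Rational.Properties using (≤-refl)
  open import Data.List using (List; []; _∷_)
  open import Data.List.Relation.Unary.All using (All; []; _∷_)
  open import Data.List.Relation.Unary.All.Properties using (++⁺; ++⁻ʳ)
  import Data.List.Relation.Unary.All as All
  open import Data.Product using (_×_; _,_; proj₁; proj₂)
  open import Relation.Binary.PropositionalEquality using (subst; sym)

  NonNegatives : List ℚ → Set
  NonNegatives = All (0ℚ ≤_)

  get-nonNeg : ∀ {xs} → NonNegatives xs → ∀ i → 0ℚ ≤ get xs i
  get-nonNeg []           i             = ≤-refl
  get-nonNeg (0≤x ∷ 0≤xs) zero          = ≤-refl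
  get-nonNeg (0≤x ∷ 0≤xs) (suc zero)    = 0≤x
  get-nonNeg (0≤x ∷ 0≤xs) (suc (suc i)) = get-nonNeg 0≤xs (suc i)

  Σ₁-nonNeg : ∀ k {f} → (∀ t → 0ℚ ≤ f t) → 0ℚ ≤ Σ₁ k f
  Σ₁-nonNeg k {f} 0≤f = subst (0ℚ ≤_) (sym (sumℚ-map-upTo (λ i → f (suc i)) (k ∸ 1)))
                               (0≤∑ (k ∸ 1) (λ i _ → 0≤f (suc i)))

  step-b-nonNeg : ∀ K {bs cs} → NonNegatives bs → NonNegatives cs → NonNegatives (proj₁ (step K (bs , cs)))
  step-b-nonNeg K {bs} 0≤bs 0≤cs = ++⁺ 0≤bs (0≤* (0≤/ 1 (2 ℕ.* suc K))
    (0≤+ (0≤* (0≤fromℕ (3 ℕ.* K ℕ.* suc K)) (0≤b K))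
         (0≤* (0≤fromℕ 3) (Σ₁-nonNeg K (λ t → 0≤* (0≤* (0≤fromℕ (t ℕ.* (K ∸ t))) (0≤b t))
                                                   (0≤b (K ∸ t)))))) ∷ [])
    where
    0≤b : ∀ t → 0ℚ ≤ get bs t
    0≤b = get-nonNeg 0≤bs

  step-c-nonNeg : ∀ K {bs cs} → NonNegatives bs → NonNegatives cs → NonNegatives (proj₂ (step K (bs , cs)))
  step-c-nonNeg K {bs} {cs} 0≤bs 0≤cs = ++⁺ 0≤cs (0≤* (0≤/ 1 (2 ℕ.* suc (suc (3 ℕ.* K))))
    (0≤+ (0≤+ (0≤+ (0≤* (0≤fromℕ (8 ℕ.* suc K)) (All.head (++⁻ʳ bs (step-b-nonNeg K 0≤bs 0≤cs))))
                   (0≤* (0≤fromℕ (3 ℕ.* K)) (0≤b K)))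
              (0≤* (0≤fromℕ ((3 ℕ.* K ℕ.+ 2) ℕ.* (3 ℕ.* K ∸ 1))) (0≤c K)))
         (0≤* (0≤fromℕ 6) (Σ₁-nonNeg K (λ t → 0≤* (0≤* (0≤fromℕ (t ℕ.* (3 ℕ.* K ∸ 3 ℕ.* t ∸ 1))) (0≤b t))
                                                   (0≤c (K ∸ t)))))) ∷ [])
    where
    0≤b : ∀ t → 0ℚ ≤ get bs t
    0≤b = get-nonNeg 0≤bs
    0≤c : ∀ t → 0ℚ ≤ get cs t
    0≤c = get-nonNeg 0≤cs

  bc-nonNeg : ∀ k → NonNegatives (proj₁ (bc k)) × NonNegatives (proj₂ (bc k))
  bc-nonNeg zero             = [] , []
  bc-nonNeg (suc zero)       = (0≤/ 5 24 ∷ []) , (0≤/ 19 24 ∷ [])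
  bc-nonNeg (suc (suc k)) with bc-nonNeg (suc k)
  ... | 0≤bs , 0≤cs = step-b-nonNeg (suc k) 0≤bs 0≤cs , step-c-nonNeg (suc k) 0≤bs 0≤cs

  b-nonNeg : ∀ k → 0ℚ ≤ b k
  b-nonNeg k = get-nonNeg (proj₁ (bc-nonNeg k)) k

  c-nonNeg : ∀ k → 0ℚ ≤ c k
  c-nonNeg k = get-nonNeg (proj₂ (bc-nonNeg k)) k

  cξ-nonNeg : ∀ (ξ : List Graph) k → 0ℚ ≤ cξ ξ k
  cξ-nonNeg ξ zero          = ≤-refl
  cξ-nonNeg ξ (suc zero)    = 0≤/ (19 ℕ.+ 6 ℕ.* rξ ξ) 24
  cξ-nonNeg ξ (suc (suc k)) =
    0≤+ (c-nonNeg (suc (suc k))) (0≤* (0≤* (0≤/ 3 2) (0≤fromℕ (rξ ξ ℕ.* suc k))) (b-nonNeg (suc k)))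

module DerivativeProducts where

  open import Defs
  open NatEmbedding
  open FiniteSums
  open PowerSeries
  open TreeFunction
  open WrightConstants
  open import Data.Nat as ℕ using (ℕ; suc; _∸_; z≤n; s≤s; _<_)
  import Data.Nat.Properties as ℕ
  open import Data.Nat.Tactic.RingSolver using (solve-∀)
  open import Data.Rational using (ℚ; _+_; _*_; _-_)
  open import Data.Rational.Properties
  open import Data.List using (List; map)
  import Data.List.Properties as List
  open import Relation.Binary.PropositionalEquality
  open import Data.Rational.Solver using (module +-*-Solver)
  open +-*-Solver

  T²invPow : ℕ → Series
  T²invPow m = powS Tz 2 ⊛ invPow m

  exponent-αα : ∀ t s → (3 ℕ.* t ℕ.+ 2) ℕ.+ (3 ℕ.* s ℕ.+ 2) ≡ 3 ℕ.* (t ℕ.+ s) ℕ.+ 4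
  exponent-αα = solve-∀

  3[1+s]∸1≡2+3s : ∀ s → 3 ℕ.* suc s ∸ 1 ≡ 2 ℕ.+ 3 ℕ.* s
  3[1+s]∸1≡2+3s = unfolded
    where
    unfolded : ∀ s → s ℕ.+ (suc s ℕ.+ (suc s ℕ.+ 0)) ≡ 2 ℕ.+ 3 ℕ.* s
    unfolded = solve-∀

  exponent-αδ : ∀ t s → (3 ℕ.* t ℕ.+ 2) ℕ.+ ((3 ℕ.* suc s ∸ 1) ℕ.+ 2) ≡ 3 ℕ.* (t ℕ.+ suc s) ℕ.+ 3
  exponent-αδ t s = trans (cong (λ m → (3 ℕ.* t ℕ.+ 2) ℕ.+ (m ℕ.+ 2)) (3[1+s]∸1≡2+3s s)) (polynomial t s)
    where
    polynomial : ∀ t s → (3 ℕ.* t ℕ.+ 2) ℕ.+ ((2 ℕ.+ 3 ℕ.* s) ℕ.+ 2) ≡ 3 ℕ.* (t ℕ.+ suc s) ℕ.+ 3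
    polynomial = solve-∀

  T²invPow-⊛-oneMinusT : ∀ m → T²invPow (suc m) ⊛ oneMinusT ≋ T²invPow m
  T²invPow-⊛-oneMinusT m n = begin
    ((powS Tz 2 ⊛ invPow (suc m)) ⊛ oneMinusT) n     ≡⟨ ⊛-assoc (powS Tz 2) (invPow (suc m)) oneMinusT n ⟩
    (powS Tz 2 ⊛ (invPow (suc m) ⊛ oneMinusT)) n     ≡⟨ ⊛-congʳ (powS Tz 2) Iᵐ⁺¹[1-T]≋Iᵐ n ⟩
    (powS Tz 2 ⊛ invPow m) n                         ∎
    where
    open ≡-Reasoning
    Iᵐ⁺¹[1-T]≋Iᵐ : invPow (suc m) ⊛ oneMinusT ≋ invPow m
    Iᵐ⁺¹[1-T]≋Iᵐ j = begin
      ((inv1mT ⊛ invPow m) ⊛ oneMinusT) j   ≡⟨ ⊛-congˡ oneMinusT (⊛-comm inv1mT (invPow m)) j ⟩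
      ((invPow m ⊛ inv1mT) ⊛ oneMinusT) j   ≡⟨ ⊛-assoc (invPow m) inv1mT oneMinusT j ⟩
      (invPow m ⊛ (inv1mT ⊛ oneMinusT)) j   ≡⟨ ⊛-congʳ (invPow m) inv1mT⊛oneMinusT j ⟩
      (invPow m ⊛ oneS) j                   ≡⟨ ⊛-identityʳ (invPow m) j ⟩
      invPow m j                            ∎

  WrightLowerBound : List Graph → ℕ → Set
  WrightLowerBound ξ t = (Ŵ ξ t ⊖ b t · invPow (3 ℕ.* t) ⊕ cξ ξ t · invPow (3 ℕ.* t ∸ 1)) ⪰ zeroS

  α : ℕ → Series
  α t = b t · θ (invPow (3 ℕ.* t))

  δ : List Graph → ℕ → Series
  δ ξ t = cξ ξ t · θ (invPow (3 ℕ.* t ∸ 1))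

  α-nonNeg : ∀ t → α t ⪰ zeroS
  α-nonNeg t = ·-nonNeg (b-nonNeg t) (θ-nonNeg (invPow-nonNeg (3 ℕ.* t)))

  δ-nonNeg : ∀ ξ t → δ ξ t ⪰ zeroS
  δ-nonNeg ξ t = ·-nonNeg (cξ-nonNeg ξ t) (θ-nonNeg (invPow-nonNeg (3 ℕ.* t ∸ 1)))

  Ŵ-nonNeg : ∀ ξ t → Ŵ ξ t ⪰ zeroS
  Ŵ-nonNeg ξ t n = 0≤/ (g ξ n t) (n ℕ.!) {{n ℕ.!≢0}}

  θŴ-lowerBound : ∀ ξ t → WrightLowerBound ξ t → θ (Ŵ ξ t) ⪰ (α t ⊖ δ ξ t)
  θŴ-lowerBound ξ t hyp = ⊖⊕⪰0⇒⪰⊖ (⪰-resp-≋ θ-linear (θ-nonNeg hyp))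
    where
    I³ᵗ I³ᵗ⁻¹ : Series
    I³ᵗ   = invPow (3 ℕ.* t)
    I³ᵗ⁻¹ = invPow (3 ℕ.* t ∸ 1)
    θ-linear : θ (Ŵ ξ t ⊖ b t · I³ᵗ ⊕ cξ ξ t · I³ᵗ⁻¹) ≋ θ (Ŵ ξ t) ⊖ α t ⊕ δ ξ t
    θ-linear n = begin
      θ (Ŵ ξ t ⊖ b t · I³ᵗ ⊕ cξ ξ t · I³ᵗ⁻¹) n
        ≡⟨ θ-⊕ (Ŵ ξ t ⊖ b t · I³ᵗ) (cξ ξ t · I³ᵗ⁻¹) n ⟩
      θ (Ŵ ξ t ⊖ b t · I³ᵗ) n + θ (cξ ξ t · I³ᵗ⁻¹) n
        ≡⟨ cong₂ _+_ (θ-⊖ (Ŵ ξ t) (b t · I³ᵗ) n) (θ-· (cξ ξ t) I³ᵗ⁻¹ n) ⟩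
      θ (Ŵ ξ t) n - θ (b t · I³ᵗ) n + δ ξ t n
        ≡⟨ cong (λ x → θ (Ŵ ξ t) n - x + δ ξ t n) (θ-· (b t) I³ᵗ n) ⟩
      θ (Ŵ ξ t) n - α t n + δ ξ t n ∎
      where open ≡-Reasoning

  θŴ⊛θŴ-lowerBound : ∀ ξ {t s} → WrightLowerBound ξ t → WrightLowerBound ξ s →
    (θ (Ŵ ξ t) ⊛ θ (Ŵ ξ s)) ⪰ (α t ⊛ α s ⊖ α t ⊛ δ ξ s ⊖ δ ξ t ⊛ α s)
  θŴ⊛θŴ-lowerBound ξ {t} {s} hypₜ hypₛ =
    ⊛-lowerBound (θ-nonNeg (Ŵ-nonNeg ξ t)) (θ-nonNeg (Ŵ-nonNeg ξ s))
                 (α-nonNeg t) (δ-nonNeg ξ t) (α-nonNeg s) (δ-nonNeg ξ s)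
                 (θŴ-lowerBound ξ t hypₜ) (θŴ-lowerBound ξ s hypₛ)

  α-closedForm : ∀ {t} → 1 ℕ.≤ t → α t ≋ (b t * fromℕ (3 ℕ.* t)) · (Tz ⊛ invPow (3 ℕ.* t ℕ.+ 2))
  α-closedForm {suc t} _ n = trans (cong (b (suc t) *_) (θ-invPow (3 ℕ.* suc t) (s≤s z≤n) n))
                                   (sym (*-assoc (b (suc t)) (fromℕ (3 ℕ.* suc t)) _))

  δ-closedForm : ∀ ξ {t} → 1 ℕ.≤ t →
    δ ξ t ≋ (cξ ξ t * fromℕ (3 ℕ.* t ∸ 1)) · (Tz ⊛ invPow (3 ℕ.* t ∸ 1 ℕ.+ 2))
  δ-closedForm ξ {suc t} _ n = trans (cong (cξ ξ (suc t) *_) (θ-invPow (3 ℕ.* suc t ∸ 1) 1≤3[1+t]∸1 n))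
                                     (sym (*-assoc (cξ ξ (suc t)) (fromℕ (3 ℕ.* suc t ∸ 1)) _))
    where
    1≤3[1+t]∸1 : 1 ℕ.≤ 3 ℕ.* suc t ∸ 1
    1≤3[1+t]∸1 = subst (1 ℕ.≤_) (sym (3[1+s]∸1≡2+3s t)) (s≤s z≤n)

  α⊛α : ∀ {t s} → 1 ℕ.≤ t → 1 ℕ.≤ s →
        α t ⊛ α s ≋ (fromℕ 9 * (fromℕ (t ℕ.* s) * b t * b s)) · T²invPow (3 ℕ.* (t ℕ.+ s) ℕ.+ 4)
  α⊛α {t} {s} 1≤t 1≤s n = begin
    (α t ⊛ α s) n
      ≡⟨ ⊛-cong (α-closedForm 1≤t) (α-closedForm 1≤s) n ⟩
    ((qₜ · (Tz ⊛ invPow (3 ℕ.* t ℕ.+ 2))) ⊛ (qₛ · (Tz ⊛ invPow (3 ℕ.* s ℕ.+ 2)))) n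
      ≡⟨ scaled-⊛-scaled qₜ qₛ Tz inv1mT (3 ℕ.* t ℕ.+ 2) (3 ℕ.* s ℕ.+ 2) n ⟩
    qₜ * qₛ * T²invPow (3 ℕ.* t ℕ.+ 2 ℕ.+ (3 ℕ.* s ℕ.+ 2)) n
      ≡⟨ cong₂ _*_ coefficient (cong (λ m → T²invPow m n) (exponent-αα t s)) ⟩
    fromℕ 9 * (fromℕ (t ℕ.* s) * b t * b s) * T²invPow (3 ℕ.* (t ℕ.+ s) ℕ.+ 4) n ∎
    where
    open ≡-Reasoning
    qₜ qₛ : ℚ
    qₜ = b t * fromℕ (3 ℕ.* t)
    qₛ = b s * fromℕ (3 ℕ.* s)
    coefficient : qₜ * qₛ ≡ fromℕ 9 * (fromℕ (t ℕ.* s) * b t * b s)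
    coefficient = begin
      b t * fromℕ (3 ℕ.* t) * (b s * fromℕ (3 ℕ.* s))
        ≡⟨ cong₂ (λ x y → b t * x * (b s * y)) (fromℕ-* 3 t) (fromℕ-* 3 s) ⟩
      b t * (fromℕ 3 * fromℕ t) * (b s * (fromℕ 3 * fromℕ s))
        ≡⟨ solve 5 (λ bt bs x3 xt xs → bt :* (x3 :* xt) :* (bs :* (x3 :* xs)) := x3 :* x3 :* (xt :* xs :* bt :* bs))
             refl (b t) (b s) (fromℕ 3) (fromℕ t) (fromℕ s) ⟩
      fromℕ 3 * fromℕ 3 * (fromℕ t * fromℕ s * b t * b s)
        ≡⟨ cong₂ (λ x y → x * (y * b t * b s)) (fromℕ-* 3 3) (fromℕ-* t s) ⟨
      fromℕ 9 * (fromℕ (t ℕ.* s) * b t * b s) ∎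

  α⊛δ : ∀ ξ {t s} → 1 ℕ.≤ t → 1 ℕ.≤ s →
        α t ⊛ δ ξ s ≋ (fromℕ 3 * (fromℕ (t ℕ.* (3 ℕ.* s ∸ 1)) * b t * cξ ξ s)) · T²invPow (3 ℕ.* (t ℕ.+ s) ℕ.+ 3)
  α⊛δ ξ {t} {suc s} 1≤t 1≤s n = begin
    (α t ⊛ δ ξ (suc s)) n
      ≡⟨ ⊛-cong (α-closedForm 1≤t) (δ-closedForm ξ 1≤s) n ⟩
    ((qₜ · (Tz ⊛ invPow (3 ℕ.* t ℕ.+ 2))) ⊛ (qₛ · (Tz ⊛ invPow (e ℕ.+ 2)))) n
      ≡⟨ scaled-⊛-scaled qₜ qₛ Tz inv1mT (3 ℕ.* t ℕ.+ 2) (e ℕ.+ 2) n ⟩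
    qₜ * qₛ * T²invPow (3 ℕ.* t ℕ.+ 2 ℕ.+ (e ℕ.+ 2)) n
      ≡⟨ cong₂ _*_ coefficient (cong (λ m → T²invPow m n) (exponent-αδ t s)) ⟩
    fromℕ 3 * (fromℕ (t ℕ.* e) * b t * c′) * T²invPow (3 ℕ.* (t ℕ.+ suc s) ℕ.+ 3) n ∎
    where
    open ≡-Reasoning
    c′ : ℚ
    c′ = cξ ξ (suc s)
    e : ℕ
    e = 3 ℕ.* suc s ∸ 1
    qₜ qₛ : ℚ
    qₜ = b t * fromℕ (3 ℕ.* t)
    qₛ = c′ * fromℕ e
    coefficient : qₜ * qₛ ≡ fromℕ 3 * (fromℕ (t ℕ.* e) * b t * c′)
    coefficient = begin
      b t * fromℕ (3 ℕ.* t) * (c′ * fromℕ e)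
        ≡⟨ cong (λ x → b t * x * (c′ * fromℕ e)) (fromℕ-* 3 t) ⟩
      b t * (fromℕ 3 * fromℕ t) * (c′ * fromℕ e)
        ≡⟨ solve 5 (λ bt c x3 xt xe → bt :* (x3 :* xt) :* (c :* xe) := x3 :* (xt :* xe :* bt :* c))
             refl (b t) c′ (fromℕ 3) (fromℕ t) (fromℕ e) ⟩
      fromℕ 3 * (fromℕ t * fromℕ e * b t * c′)
        ≡⟨ cong (λ x → fromℕ 3 * (x * b t * c′)) (fromℕ-* t e) ⟨
      fromℕ 3 * (fromℕ (t ℕ.* e) * b t * c′) ∎

  private
    ∑-factor : ∀ q w (f : ℕ → ℚ) K → ∑ (λ i → q * f i * w) K ≡ q * ∑ f K * w
    ∑-factor q w f K = trans (∑-*ʳ w (λ i → q * f i) K) (cong (_* w) (∑-*ˡ q f K))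

    1+i+[K∸i]≡1+K : ∀ {i K} → i < K → suc i ℕ.+ (K ∸ i) ≡ suc K
    1+i+[K∸i]≡1+K i<K = cong suc (ℕ.m+[n∸m]≡n (ℕ.<⇒≤ i<K))

  ∑-α⊛α : ∀ K n →
    ∑ (λ i → (α (suc i) ⊛ α (K ∸ i)) n) K ≡ fromℕ 9 * 𝓑 (suc K) * T²invPow (3 ℕ.* suc K ℕ.+ 4) n
  ∑-α⊛α K n = begin
    ∑ (λ i → (α (suc i) ⊛ α (K ∸ i)) n) K
      ≡⟨ ∑-cong K (λ i i<K → trans (α⊛α {suc i} {K ∸ i} (s≤s z≤n) (ℕ.m<n⇒0<n∸m i<K) n)
                                   (cong (λ t → fromℕ 9 * F (suc i) * T²invPow (3 ℕ.* t ℕ.+ 4) n) (1+i+[K∸i]≡1+K i<K))) ⟩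
    ∑ (λ i → fromℕ 9 * F (suc i) * W₄) K
      ≡⟨ ∑-factor (fromℕ 9) W₄ (λ i → F (suc i)) K ⟩
    fromℕ 9 * ∑ (λ i → F (suc i)) K * W₄
      ≡⟨ cong (λ x → fromℕ 9 * x * W₄) (sumℚ-map-upTo (λ i → F (suc i)) K) ⟨
    fromℕ 9 * 𝓑 (suc K) * W₄ ∎
    where
    open ≡-Reasoning
    W₄ : ℚ
    W₄ = T²invPow (3 ℕ.* suc K ℕ.+ 4) n
    F : ℕ → ℚ
    F t = fromℕ (t ℕ.* (suc K ∸ t)) * b t * b (suc K ∸ t)

  ∑-α⊛δ : ∀ ξ K n →
    ∑ (λ i → (α (suc i) ⊛ δ ξ (K ∸ i)) n) K ≡ fromℕ 3 * 𝓒 ξ (suc K) * T²invPow (3 ℕ.* suc K ℕ.+ 3) n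
  ∑-α⊛δ ξ K n = begin
    ∑ (λ i → (α (suc i) ⊛ δ ξ (K ∸ i)) n) K
      ≡⟨ ∑-cong K (λ i i<K → trans (α⊛δ ξ {suc i} {K ∸ i} (s≤s z≤n) (ℕ.m<n⇒0<n∸m i<K) n) (reindex i i<K)) ⟩
    ∑ (λ i → fromℕ 3 * G (suc i) * W₃) K
      ≡⟨ ∑-factor (fromℕ 3) W₃ (λ i → G (suc i)) K ⟩
    fromℕ 3 * ∑ (λ i → G (suc i)) K * W₃
      ≡⟨ cong (λ x → fromℕ 3 * x * W₃) (sumℚ-map-upTo (λ i → G (suc i)) K) ⟨
    fromℕ 3 * 𝓒 ξ (suc K) * W₃ ∎
    where
    open ≡-Reasoning
    W₃ : ℚ
    W₃ = T²invPow (3 ℕ.* suc K ℕ.+ 3) n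
    G : ℕ → ℚ
    G t = fromℕ (t ℕ.* (3 ℕ.* suc K ∸ 3 ℕ.* t ∸ 1)) * b t * cξ ξ (suc K ∸ t)
    reindex : ∀ i → i < K →
      fromℕ 3 * (fromℕ (suc i ℕ.* (3 ℕ.* (K ∸ i) ∸ 1)) * b (suc i) * cξ ξ (K ∸ i))
        * T²invPow (3 ℕ.* (suc i ℕ.+ (K ∸ i)) ℕ.+ 3) n
      ≡ fromℕ 3 * G (suc i) * W₃
    reindex i i<K =
      cong₂ (λ e t → fromℕ 3 * (fromℕ (suc i ℕ.* e) * b (suc i) * cξ ξ (K ∸ i)) * T²invPow (3 ℕ.* t ℕ.+ 3) n)
            (cong (_∸ 1) (ℕ.*-distribˡ-∸ 3 (suc K) (suc i))) (1+i+[K∸i]≡1+K i<K)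

  ∑-δ⊛α : ∀ ξ K n → ∑ (λ i → (δ ξ (suc i) ⊛ α (K ∸ i)) n) K ≡ ∑ (λ i → (α (suc i) ⊛ δ ξ (K ∸ i)) n) K
  ∑-δ⊛α ξ K n = trans (∑-reverse (λ i → (δ ξ (suc i) ⊛ α (K ∸ i)) n) K) (∑-cong K (λ i i<K →
    trans (cong₂ (λ t s → (δ ξ t ⊛ α s) n) (sym (ℕ.+-∸-assoc 1 {K} {suc i} i<K)) (ℕ.m∸[m∸n]≡n {K} {suc i} i<K))
          (⊛-comm (δ ξ (K ∸ i)) (α (suc i)) n)))

  T²invPow-⊛-[q-r[1-T]] : ∀ m q r →
    (T²invPow (suc m) ⊛ (constS q ⊖ r · oneMinusT)) ≋ (q · T²invPow (suc m) ⊖ r · T²invPow m)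
  T²invPow-⊛-[q-r[1-T]] m q r n = begin
    (T²invPow (suc m) ⊛ (constS q ⊖ r · oneMinusT)) n
      ≡⟨ ⊛-distribˡ-⊖ (T²invPow (suc m)) (constS q) (r · oneMinusT) n ⟩
    (T²invPow (suc m) ⊛ (q · oneS)) n - (T²invPow (suc m) ⊛ (r · oneMinusT)) n
      ≡⟨ cong₂ _-_ (trans (⊛-· q (T²invPow (suc m)) oneS n) (cong (q *_) (⊛-identityʳ (T²invPow (suc m)) n)))
                   (trans (⊛-· r (T²invPow (suc m)) oneMinusT n) (cong (r *_) (T²invPow-⊛-oneMinusT m n))) ⟩
    q * T²invPow (suc m) n - r * T²invPow m n ∎
    where open ≡-Reasoning

  ∑-lowerBounds≡rhs : ∀ ξ K n →
    ∑ (λ i → (α (suc i) ⊛ α (K ∸ i) ⊖ α (suc i) ⊛ δ ξ (K ∸ i) ⊖ δ ξ (suc i) ⊛ α (K ∸ i)) n) K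
    ≡ (T²invPow (3 ℕ.* suc K ℕ.+ 4) ⊛ (constS (fromℕ 9 * 𝓑 (suc K)) ⊖ (fromℕ 6 * 𝓒 ξ (suc K)) · oneMinusT)) n
  ∑-lowerBounds≡rhs ξ K n = begin
    ∑ (λ i → αα i - αδ i - δα i) K
      ≡⟨ ∑-distrib-minus (λ i → αα i - αδ i) δα K ⟩
    ∑ (λ i → αα i - αδ i) K - ∑ δα K
      ≡⟨ cong (λ x → x - ∑ δα K) (∑-distrib-minus αα αδ K) ⟩
    ∑ αα K - ∑ αδ K - ∑ δα K
      ≡⟨ cong₂ _-_ (cong₂ _-_ (∑-α⊛α K n) (∑-α⊛δ ξ K n)) (trans (∑-δ⊛α ξ K n) (∑-α⊛δ ξ K n)) ⟩
    q₉ * W₄ - fromℕ 3 * 𝓒 ξ k * W₃ - fromℕ 3 * 𝓒 ξ k * W₃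
      ≡⟨ solve 4 (λ x3 c w₃ u → u :- x3 :* c :* w₃ :- x3 :* c :* w₃ := u :- (x3 :+ x3) :* c :* w₃)
           refl (fromℕ 3) (𝓒 ξ k) W₃ (q₉ * W₄) ⟩
    q₉ * W₄ - (fromℕ 3 + fromℕ 3) * 𝓒 ξ k * W₃
      ≡⟨ cong (λ x → q₉ * W₄ - x * 𝓒 ξ k * W₃) (fromℕ-+ 3 3) ⟨
    q₉ * W₄ - q₆ * W₃
      ≡⟨ cong (λ m → q₉ * T²invPow m n - q₆ * W₃) (ℕ.+-suc (3 ℕ.* k) 3) ⟩
    q₉ * T²invPow (suc (3 ℕ.* k ℕ.+ 3)) n - q₆ * W₃
      ≡⟨ T²invPow-⊛-[q-r[1-T]] (3 ℕ.* k ℕ.+ 3) q₉ q₆ n ⟨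
    (T²invPow (suc (3 ℕ.* k ℕ.+ 3)) ⊛ (constS q₉ ⊖ q₆ · oneMinusT)) n
      ≡⟨ cong (λ m → (T²invPow m ⊛ (constS q₉ ⊖ q₆ · oneMinusT)) n) (ℕ.+-suc (3 ℕ.* k) 3) ⟨
    (T²invPow (3 ℕ.* k ℕ.+ 4) ⊛ (constS q₉ ⊖ q₆ · oneMinusT)) n ∎
    where
    open ≡-Reasoning
    k : ℕ
    k = suc K
    q₉ q₆ W₄ W₃ : ℚ
    q₉ = fromℕ 9 * 𝓑 k
    q₆ = fromℕ 6 * 𝓒 ξ k
    W₄ = T²invPow (3 ℕ.* k ℕ.+ 4) n
    W₃ = T²invPow (3 ℕ.* k ℕ.+ 3) n
    αα αδ δα : ℕ → ℚ
    αα i = (α (suc i) ⊛ α (K ∸ i)) n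
    αδ i = (α (suc i) ⊛ δ ξ (K ∸ i)) n
    δα i = (δ ξ (suc i) ⊛ α (K ∸ i)) n

  Λ-coeff : ∀ ξ K n → Λ ξ (suc K) n ≡ ∑ (λ i → (θ (Ŵ ξ (suc i)) ⊛ θ (Ŵ ξ (K ∸ i))) n) K
  Λ-coeff ξ K n = trans (cong (λ ts → sumℚ (map F ts)) (List.map-upTo suc K)) (sumℚ-map-applyUpTo F suc K)
    where
    F : ℕ → ℚ
    F t = (θ (Ŵ ξ t) ⊛ θ (Ŵ ξ (suc K ∸ t))) n

open import Defs
open import Data.Nat using (ℕ; _≤_; _*_; _+_; _∸_)
open import Data.List using (List)
open import Data.List.Relation.Unary.All using (All)
open import Data.Product using (_×_)
open import Data.Rational using () renaming (_*_ to _ℚ*_)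

open import Data.Nat using (suc; s≤s; z≤n)
open import Data.Nat.Properties using (m<n⇒0<n∸m; m∸n≤m)
open import Data.Rational.Properties using (module ≤-Reasoning)
open FiniteSums using (∑; ∑-mono-≤)
open DerivativeProducts using (α; δ; θŴ⊛θŴ-lowerBound; ∑-lowerBounds≡rhs; Λ-coeff)

lemma23 : (ξ : List Graph) → All (λ H → Simple H × Connected H × ContainsCycle H) ξ →
    (k : ℕ) → 1 ≤ k →
    ((t : ℕ) → 1 ≤ t → t ≤ k ∸ 1 →
      (Ŵ ξ t ⊖ b t · invPow (3 * t) ⊕ cξ ξ t · invPow (3 * t ∸ 1)) ⪰ zeroS) →
    Λ ξ k ⪰ (powS Tz 2 ⊛ invPow (3 * k + 4)
              ⊛ (constS (fromℕ 9 ℚ* 𝓑 k) ⊖ (fromℕ 6 ℚ* 𝓒 ξ k) · oneMinusT))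
lemma23 ξ _ (suc K) _ hyp n = begin
  (powS Tz 2 ⊛ invPow (3 * suc K + 4) ⊛ (constS (fromℕ 9 ℚ* 𝓑 (suc K)) ⊖ (fromℕ 6 ℚ* 𝓒 ξ (suc K)) · oneMinusT)) n
    ≡⟨ ∑-lowerBounds≡rhs ξ K n ⟨
  ∑ (λ i → (α (suc i) ⊛ α (K ∸ i) ⊖ α (suc i) ⊛ δ ξ (K ∸ i) ⊖ δ ξ (suc i) ⊛ α (K ∸ i)) n) K
    ≤⟨ ∑-mono-≤ K (λ i i<K → θŴ⊛θŴ-lowerBound ξ (hyp (suc i) (s≤s z≤n) i<K)
                                                 (hyp (K ∸ i) (m<n⇒0<n∸m i<K) (m∸n≤m K i)) n) ⟩
  ∑ (λ i → (θ (Ŵ ξ (suc i)) ⊛ θ (Ŵ ξ (K ∸ i))) n) K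
    ≡⟨ Λ-coeff ξ K n ⟨
  Λ ξ (suc K) n ∎
  where open ≤-Reasoning
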